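{- $\mathrm{IsoSpec}(\mathcal{M},\mathcal{N})=\bigcup_{i<\omega}\mathrm{IsoSpec}(\mathcal{A}_i,\mathcal{B}_i)$.
   Context: All structures are relational. $\mathrm{IsoSpec}(\mathcal{A},\mathcal{B})$ is the set of Turing degrees computing some isomorphism $\mathcal{A}\cong\mathcal{B}$. $\mathcal{H}$ has universe $H=[\omega]^{<\omega}\cup(\omega\times\{0,1\})$ ($[\omega]^{<\omega}$ the finite subsets of $\omega$, identified with characteristic functions) and binary relations $E_i$ ($i<\omega$), with $E_i(X,Y)$ iff $X,Y$ finite sets and $X\triangle Y=\{i\}$, and $D_i$, with $D_i(X,(i,a))$ iff $X$ is a finite set and $X(i)=a$ (nothing else). Computably composite structure: given a computable structure $\mathcal{S}$ with universe $S$ and a uniformly computable collection $\{\mathcal{C}_x:x\in S\}$ (uniformly computable languages and atomic diagrams) with pairwise disjoint universes $C_x$ disjoint from $S$, $\mathcal{S}[\{\mathcal{C}_x\}]$ has universe $S\cup\bigcup_xC_x$, a new binary relation $\mu=\{(c,x):c\in C_x\}\cup\{(x,x):x\in S\}$, the relations of $\mathcal{S}$ on $S$, the relations of each $\mathcal{C}_x$ on $C_x$, and nothing else. Fix uniformly computable collections $\{\mathcal{A}_i:i<\omega\}$, $\{\mathcal{B}_i:i<\omega\}$ with $\mathcal{A}_i\cong\mathcal{B}_i$. For $z\in H$ define: $\mathcal{M}_{(i,0)}=\mathcal{N}_{(i,0)}=\{(i,0)\}\times\mathcal{A}_{i+1}$; $\mathcal{M}_{(i,1)}=\mathcal{N}_{(i,1)}=\{(i,1)\}\times\mathcal{B}_{i+1}$;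 for $X\in[\omega]^{<\omega}$, $\mathcal{M}_X=\{X\}\times\mathcal{A}_0$ and $\mathcal{N}_X=\{X\}\times\mathcal{B}_0$ if $|X|$ is even, and $\mathcal{M}_X=\{X\}\times\mathcal{B}_0$ and $\mathcal{N}_X=\{X\}\times\mathcal{A}_0$ if $|X|$ is odd ($\{z\}\times\mathcal{C}$ denotes the copy of $\mathcal{C}$ with universe $\{z\}\times C$). Let $\mathcal{M}=\mathcal{H}[\{\mathcal{M}_z:z\in H\}]$ and $\mathcal{N}=\mathcal{H}[\{\mathcal{N}_z:z\in H\}]$. -}

module Defs where

open import Data.Nat using (ℕ; zero; suc; _+_; _<_; _≡ᵇ_; _%_; ⌊_/2⌋)
open import Data.Fin using (Fin)
open import Data.Vec using (Vec; []; _∷_; lookup)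
open import Data.Bool using (Bool; true; false; _∧_; _xor_; not)
open import Data.List using (List; []; _∷_; map; upTo)
open import Data.Nat.ListAction using (sum)
open import Data.Bool.ListAction using (all)
open import Data.List.Relation.Unary.All using (All)
open import Data.Maybe using (Maybe; just; nothing)
open import Data.Product using (Σ; _×_; _,_)
open import Relation.Binary.PropositionalEquality using (_≡_)

Oracle : Set
Oracle = ℕ → Bool

b2n : Bool → ℕ
b2n true  = 1
b2n false = 0

data PR : ℕ → Set where
  zer  : ∀ {n} → PR n
  sc   : PR 1
  prj  : ∀ {n} → Fin n → PR n
  orc  : PR 1
  comp : ∀ {n m} → PR m → Vec (PR n) m → PR n
  prec : ∀ {n} → PR n → PR (suc (suc n)) → PR (suc n)
  mu   : ∀ {n} → PR (suc n) → PR n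

mutual
  data _⊢_[_]⇓_ (X : Oracle) : ∀ {n} → PR n → Vec ℕ n → ℕ → Set where
    ezer   : ∀ {n} {xs : Vec ℕ n} → X ⊢ zer [ xs ]⇓ 0
    esc    : ∀ {x} → X ⊢ sc [ x ∷ [] ]⇓ suc x
    eprj   : ∀ {n} {i : Fin n} {xs} → X ⊢ prj i [ xs ]⇓ lookup xs i
    eorc   : ∀ {x} → X ⊢ orc [ x ∷ [] ]⇓ b2n (X x)
    ecomp  : ∀ {n m} {f : PR m} {gs : Vec (PR n) m} {xs ys y} →
             X ⊢ gs [ xs ]⇓* ys → X ⊢ f [ ys ]⇓ y → X ⊢ comp f gs [ xs ]⇓ y
    eprec0 : ∀ {n} {g : PR n} {h} {xs : Vec ℕ n} {y} →
             X ⊢ g [ xs ]⇓ y → X ⊢ prec g h [ 0 ∷ xs ]⇓ y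
    eprecS : ∀ {n} {g : PR n} {h} {xs : Vec ℕ n} {k r y} →
             X ⊢ prec g h [ k ∷ xs ]⇓ r → X ⊢ h [ k ∷ r ∷ xs ]⇓ y →
             X ⊢ prec g h [ suc k ∷ xs ]⇓ y
    emu    : ∀ {n} {f : PR (suc n)} {xs : Vec ℕ n} {y} →
             X ⊢ f [ y ∷ xs ]⇓ 0 →
             (∀ z → z < y → Σ ℕ λ v → X ⊢ f [ z ∷ xs ]⇓ suc v) →
             X ⊢ mu f [ xs ]⇓ y

  data _⊢_[_]⇓*_ (X : Oracle) : ∀ {n m} → Vec (PR n) m → Vec ℕ n → Vec ℕ m → Set where
    []  : ∀ {n} {xs : Vec ℕ n} → X ⊢ [] [ xs ]⇓* []
    _∷_ : ∀ {n m} {g : PR n} {gs : Vec (PR n) m} {xs y ys} →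
          X ⊢ g [ xs ]⇓ y → X ⊢ gs [ xs ]⇓* ys → X ⊢ (g ∷ gs) [ xs ]⇓* (y ∷ ys)

∅ : Oracle
∅ _ = false

-- Coding: a bijection ℕ → ℕ × ℕ (Cantor-style enumeration of diagonals)

next : ℕ × ℕ → ℕ × ℕ
next (zero  , b) = (suc b , zero)
next (suc a , b) = (a , suc b)

unpair : ℕ → ℕ × ℕ
unpair zero    = (0 , 0)
unpair (suc n) = next (unpair n)

-- lists coded by numbers: 0 = [], suc (pair a b) = a ∷ (list b)
decodeListF : ℕ → ℕ → List ℕ
decodeListF _ zero = []
decodeListF zero (suc _) = []
decodeListF (suc f) (suc n) with unpair n
... | (a , b) = a ∷ decodeListF f b

decodeList : ℕ → List ℕ
decodeList n = decodeListF n n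

-- Relation symbols are numbers k; Rel k xs says whether the tuple xs
-- (of any length) is in the relation named k.  Symbols/arities not in the
-- language are interpreted as empty.

record Str : Set where
  field
    Dom : ℕ → Bool
    Rel : ℕ → List ℕ → Bool
open Str public

InDom : Str → ℕ → Set
InDom S a = Dom S a ≡ true

IsIso : Str → Str → (ℕ → ℕ) → Set
IsIso S T f =
    (∀ a → InDom S a → InDom T (f a))
  × (∀ a a' → InDom S a → InDom S a' → f a ≡ f a' → a ≡ a')
  × (∀ b → InDom T b → Σ ℕ λ a → InDom S a × f a ≡ b)
  × (∀ k (xs : List ℕ) → All (InDom S) xs → Rel S k xs ≡ Rel T k (map f xs))

Isomorphic : Str → Str → Set
Isomorphic S T = Σ (ℕ → ℕ) λ f → IsIso S T f

ComputesIso : Oracle → Str → Str → Set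
ComputesIso X S T =
  Σ (PR 1) λ e → Σ (ℕ → ℕ) λ f →
    (∀ a → InDom S a → X ⊢ e [ a ∷ [] ]⇓ f a) × IsIso S T f

-- IsoSpec(S,T), as a set of oracles (degree-invariant: d ∈ IsoSpec iff
-- any/every X ∈ d computes an isomorphism)
IsoSpec : Str → Str → Oracle → Set
IsoSpec S T X = ComputesIso X S T

UnifComputable : (ℕ → Str) → Set
UnifComputable A =
  Σ (PR 2) λ eD → Σ (PR 3) λ eR →
    (∀ i n → ∅ ⊢ eD [ i ∷ n ∷ [] ]⇓ b2n (Dom (A i) n))
  × (∀ i k t → ∅ ⊢ eR [ i ∷ k ∷ t ∷ [] ]⇓ b2n (Rel (A i) k (decodeList t)))

-- Finite sets coded by canonical index r (i ∈ r iff bit i of r is 1)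

bit : ℕ → ℕ → Bool
bit r zero    = r % 2 ≡ᵇ 1
bit r (suc i) = bit ⌊ r /2⌋ i

card : ℕ → ℕ
card r = sum (map (λ j → b2n (bit r j)) (upTo r))

evenCard : ℕ → Bool
evenCard r = card r % 2 ≡ᵇ 0

-- r △ s = {i}   (all bits ≥ r + s + i + 1 are 0 in r and s)
symDiffIs : ℕ → ℕ → ℕ → Bool
symDiffIs r s i = all (λ j → not ((bit r j xor bit s j) xor (j ≡ᵇ i))) (upTo (suc (r + s + i)))

data HElt : Set where
  fs : ℕ → HElt            -- the finite set with canonical index r
  pt : ℕ → Bool → HElt     -- (i , a) ∈ ω × {0,1}   (false = 0, true = 1)

eqB : Bool → Bool → Bool
eqB a b = not (a xor b)

eqH : HElt → HElt → Bool
eqH (fs r) (fs s) = r ≡ᵇ s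
eqH (pt i a) (pt j b) = (i ≡ᵇ j) ∧ eqB a b
eqH _ _ = false

decodePt : ℕ × ℕ → Maybe HElt
decodePt (i , 0) = just (pt i false)
decodePt (i , 1) = just (pt i true)
decodePt _ = nothing

decodeH' : ℕ × ℕ → Maybe HElt
decodeH' (0 , r) = just (fs r)
decodeH' (1 , r) = decodePt (unpair r)
decodeH' _ = nothing

decodeH : ℕ → Maybe HElt
decodeH n = decodeH' (unpair n)

-- elements of H[{C_z}]: base z (z ∈ H) or (z , c) with c ∈ C_z
data CElt : Set where
  base : HElt → CElt
  inC  : HElt → ℕ → CElt

decodeC' : ℕ × ℕ → Maybe CElt
decodeC' (0 , r) with decodeH r
... | just z  = just (base z)
... | nothing = nothing
decodeC' (1 , r) with unpair r
... | (w , c) with decodeH w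
...   | just z  = just (inC z c)
...   | nothing = nothing
decodeC' _ = nothing

decodeC : ℕ → Maybe CElt
decodeC n = decodeC' (unpair n)

ERel : ℕ → List ℕ → Bool
ERel i (u ∷ v ∷ []) with decodeC u | decodeC v
... | just (base (fs r)) | just (base (fs s)) = symDiffIs r s i
... | _ | _ = false
ERel i _ = false

DRel : ℕ → List ℕ → Bool
DRel i (u ∷ v ∷ []) with decodeC u | decodeC v
... | just (base (fs r)) | just (base (pt j a)) = (j ≡ᵇ i) ∧ eqB (bit r i) a
... | _ | _ = false
DRel i _ = false

MuRel : List ℕ → Bool
MuRel (u ∷ v ∷ []) with decodeC u | decodeC v
... | just (inC z c) | just (base z') = eqH z z'
... | just (base z)  | just (base z') = eqH z z'
... | _ | _ = false
MuRel _ = false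

collect : HElt → List ℕ → Maybe (List ℕ)
collect z [] = just []
collect z (u ∷ us) with decodeC u | collect z us
... | just (inC z' c) | just cs with eqH z z'
...   | true  = just (c ∷ cs)
...   | false = nothing
collect z (u ∷ us) | _ | _ = nothing

CRel : (HElt → Str) → ℕ → List ℕ → Bool
CRel C k [] = false
CRel C k (u ∷ us) with decodeC u
... | just (inC z c) with collect z (u ∷ us)
...   | just cs = Rel (C z) k cs
...   | nothing = false
CRel C k (u ∷ us) | _ = false

HSym : ℕ × ℕ → List ℕ → Bool
HSym (0 , i) = ERel i
HSym (1 , i) = DRel i
HSym _ = λ _ → false

-- symbol codes: (0,(0,i)) = E_i, (0,(1,i)) = D_i, (1,_) = μ, (2,k) = symbol k of the C_z
CompRel' : (HElt → Str) → ℕ × ℕ → List ℕ → Bool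
CompRel' C (0 , k) = HSym (unpair k)
CompRel' C (1 , _) = MuRel
CompRel' C (2 , k) = CRel C k
CompRel' C _ = λ _ → false

CompDom : (HElt → Str) → ℕ → Bool
CompDom C n with decodeC n
... | just (base _)  = true
... | just (inC z c) = Dom (C z) c
... | nothing        = false

composite : (HElt → Str) → Str
composite C = record { Dom = CompDom C ; Rel = λ k → CompRel' C (unpair k) }

Mfam : (ℕ → Str) → (ℕ → Str) → HElt → Str
Mfam A B (pt i false) = A (suc i)
Mfam A B (pt i true)  = B (suc i)
Mfam A B (fs r) with evenCard r
... | true  = A 0
... | false = B 0

Nfam : (ℕ → Str) → (ℕ → Str) → HElt → Str
Nfam A B (pt i false) = A (suc i)
Nfam A B (pt i true)  = B (suc i)
Nfam A B (fs r) with evenCard r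
... | true  = B 0
... | false = A 0

𝓜 : (ℕ → Str) → (ℕ → Str) → Str
𝓜 A B = composite (Mfam A B)

𝓝 : (ℕ → Str) → (ℕ → Str) → Str
𝓝 A B = composite (Nfam A B)

-- If X computes g : A₀ ≅ B₀, then the map that fixes H and acts on the fibre over a finite set
-- by g when the set has even size and by g⁻¹ when it has odd size is an X-computable isomorphism
-- 𝓜 ≅ 𝓝.  If X computes g : A_{j+1} ≅ B_{j+1}, relabel H instead by the automorphism toggling
-- j: it swaps (j,0) with (j,1) and changes the parity of every finite set, so the fibres over
-- finite sets now match identically and those over (j,0) and (j,1) via g and g⁻¹.  The inverse
-- g⁻¹ is X-computable by search, since the domains of the Aᵢ are uniformly decidable.
-- Conversely, an isomorphism F : 𝓜 ≅ 𝓝 preserves D₀, so it maps ∅ to a finite set t.  If t = ∅,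
-- F restricts to the fibres over ∅, that is, to A₀ ≅ B₀.  Otherwise pick j ∈ t: as D_j(∅,(j,0))
-- holds, so does D_j(t, F(j,0)), which forces F(j,0) = (j,1), and F restricts to A_{j+1} ≅ B_{j+1}.

module Submission where

open import Defs
open import Data.Nat
open import Data.Nat.Properties
open import Data.Bool using (Bool; true; false; _∧_; _xor_; not; if_then_else_)
open import Data.Bool.Properties using (∧-isMonoid; xor-assoc; xor-comm; xor-identityʳ; xor-same; true-xor; not-involutive; xor-∧-commutativeRing)
open import Algebra.Bundles using (CommutativeRing)
open import Algebra.Structures using (IsMonoid)
import Algebra.Properties.CommutativeSemigroup as CommSemigroupProperties
open import Data.Fin using (Fin; zero; suc)
open import Data.Vec using (Vec; []; _∷_; lookup)
open import Data.List using (List; []; _∷_; map; upTo; foldr; _∷ʳ_)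
open import Data.List.Properties using (upTo-∷ʳ; foldr-∷ʳ; map-++; map-id)
open import Data.List.Relation.Unary.All using (All; []; _∷_)
open import Data.Maybe using (Maybe; just; nothing) renaming (map to mapM)
open import Data.Maybe.Properties using (just-injective)
open import Data.Product using (Σ; _×_; _,_; proj₁; proj₂; ∃; uncurry)
open import Data.Empty using (⊥; ⊥-elim)
open import Function.Base using (_∘_)
open import Function.Bundles using (_⇔_; mk⇔)
open import Relation.Nullary using (yes; no)
open import Relation.Binary.Definitions using (tri<; tri≈; tri>)
open import Relation.Binary.PropositionalEquality

triangle : ℕ → ℕ
triangle zero = zero
triangle (suc d) = suc d + triangle d

pair : ℕ → ℕ → ℕ
pair a b = triangle (a + b) + b

pair-next : ∀ p → uncurry pair (next p) ≡ suc (uncurry pair p)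
pair-next (zero , b) = begin
    triangle (suc b + 0) + 0 ≡⟨ +-identityʳ _ ⟩
    triangle (suc b + 0) ≡⟨ cong triangle (+-identityʳ (suc b)) ⟩
    suc b + triangle b ≡⟨ +-comm (suc b) (triangle b) ⟩
    triangle b + suc b ≡⟨ +-suc (triangle b) b ⟩
    suc (triangle b + b) ∎
  where open ≡-Reasoning
pair-next (suc a , b) = begin
    triangle (a + suc b) + suc b ≡⟨ cong (λ x → triangle x + suc b) (+-suc a b) ⟩
    triangle (suc (a + b)) + suc b ≡⟨ +-suc _ b ⟩
    suc (triangle (suc a + b) + b) ∎
  where open ≡-Reasoning

pair-unpair : ∀ n → uncurry pair (unpair n) ≡ n
pair-unpair zero = refl
pair-unpair (suc n) = trans (pair-next (unpair n)) (cong suc (pair-unpair n))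

triangle-mono-≤ : ∀ {s t} → s ≤ t → triangle s ≤ triangle t
triangle-mono-≤ {zero} _ = z≤n
triangle-mono-≤ {suc s} {suc t} (s≤s le) = +-mono-≤ (s≤s le) (triangle-mono-≤ le)

triangle+≤<triangle-suc : ∀ s b → b ≤ s → triangle s + b < triangle (suc s)
triangle+≤<triangle-suc s b le = begin-strict
    triangle s + b ≤⟨ +-monoʳ-≤ (triangle s) le ⟩
    triangle s + s <⟨ +-monoʳ-< (triangle s) (n<1+n s) ⟩
    triangle s + suc s ≡⟨ +-comm (triangle s) (suc s) ⟩
    triangle (suc s) ∎
  where open ≤-Reasoning

triangle+≤-injective : ∀ s b s' b' → b ≤ s → b' ≤ s' → triangle s + b ≡ triangle s' + b' → s ≡ s'
triangle+≤-injective s b s' b' le le' eq with <-cmp s s'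
... | tri≈ _ e _ = e
... | tri< lt _ _ = ⊥-elim (<-irrefl eq (begin-strict
        triangle s + b <⟨ triangle+≤<triangle-suc s b le ⟩
        triangle (suc s) ≤⟨ triangle-mono-≤ lt ⟩
        triangle s' ≤⟨ m≤m+n (triangle s') b' ⟩
        triangle s' + b' ∎))
  where open ≤-Reasoning
... | tri> _ _ gt = ⊥-elim (<-irrefl (sym eq) (begin-strict
        triangle s' + b' <⟨ triangle+≤<triangle-suc s' b' le' ⟩
        triangle (suc s') ≤⟨ triangle-mono-≤ gt ⟩
        triangle s ≤⟨ m≤m+n (triangle s) b ⟩
        triangle s + b ∎))
  where open ≤-Reasoning

pair-injective : ∀ a b a' b' → pair a b ≡ pair a' b' → (a ≡ a') × (b ≡ b')
pair-injective a b a' b' eq = a≡ , b≡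
  where
    s≡ : a + b ≡ a' + b'
    s≡ = triangle+≤-injective (a + b) b (a' + b') b' (m≤n+m b a) (m≤n+m b' a') eq
    b≡ : b ≡ b'
    b≡ = +-cancelˡ-≡ (triangle (a + b)) b b' (trans eq (cong (λ x → triangle x + b') (sym s≡)))
    a≡ : a ≡ a'
    a≡ = +-cancelʳ-≡ b a a' (trans s≡ (cong (a' +_) (sym b≡)))

unpair-pair : ∀ a b → unpair (pair a b) ≡ (a , b)
unpair-pair a b with unpair (pair a b) | pair-unpair (pair a b)
... | (a' , b') | eq with pair-injective a' b' a b eq
... | refl , refl = refl

unpair₁ unpair₂ : ℕ → ℕ
unpair₁ n = proj₁ (unpair n)
unpair₂ n = proj₂ (unpair n)

unpair₁-pair : ∀ a b → unpair₁ (pair a b) ≡ a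
unpair₁-pair a b = cong proj₁ (unpair-pair a b)
unpair₂-pair : ∀ a b → unpair₂ (pair a b) ≡ b
unpair₂-pair a b = cong proj₂ (unpair-pair a b)

encodeH : HElt → ℕ
encodeH (fs r) = pair 0 r
encodeH (pt i a) = pair 1 (pair i (b2n a))

encodeC : CElt → ℕ
encodeC (base z) = pair 0 (encodeH z)
encodeC (inC z c) = pair 1 (pair (encodeH z) c)

unpair₁-encodeC-base : ∀ z → unpair₁ (encodeC (base z)) ≡ 0
unpair₁-encodeC-base z = unpair₁-pair 0 (encodeH z)

unpair₂-encodeC-base : ∀ z → unpair₂ (encodeC (base z)) ≡ encodeH z
unpair₂-encodeC-base z = unpair₂-pair 0 (encodeH z)

unpair₁-encodeC-inC : ∀ z c → unpair₁ (encodeC (inC z c)) ≡ 1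
unpair₁-encodeC-inC z c = unpair₁-pair 1 (pair (encodeH z) c)

unpair₁₂-encodeC-inC : ∀ z c → unpair₁ (unpair₂ (encodeC (inC z c))) ≡ encodeH z
unpair₁₂-encodeC-inC z c = trans (cong unpair₁ (unpair₂-pair 1 (pair (encodeH z) c))) (unpair₁-pair (encodeH z) c)

unpair₂₂-encodeC-inC : ∀ z c → unpair₂ (unpair₂ (encodeC (inC z c))) ≡ c
unpair₂₂-encodeC-inC z c = trans (cong unpair₂ (unpair₂-pair 1 (pair (encodeH z) c))) (unpair₂-pair (encodeH z) c)

decodeH-encodeH : ∀ z → decodeH (encodeH z) ≡ just z
decodeH-encodeH (fs r) rewrite unpair-pair 0 r = refl
decodeH-encodeH (pt i false) rewrite unpair-pair 1 (pair i 0) | unpair-pair i 0 = refl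
decodeH-encodeH (pt i true) rewrite unpair-pair 1 (pair i 1) | unpair-pair i 1 = refl

decodeC-encodeC : ∀ x → decodeC (encodeC x) ≡ just x
decodeC-encodeC (base z) rewrite unpair-pair 0 (encodeH z) | decodeH-encodeH z = refl
decodeC-encodeC (inC z c) rewrite unpair-pair 1 (pair (encodeH z) c) | unpair-pair (encodeH z) c | decodeH-encodeH z = refl

decodePt-sound : ∀ q z → decodePt q ≡ just z → encodeH z ≡ pair 1 (uncurry pair q)
decodePt-sound (i , 0) .(pt i false) refl = refl
decodePt-sound (i , 1) .(pt i true) refl = refl
decodePt-sound (i , suc (suc _)) z ()

decodeH'-sound : ∀ p z → decodeH' p ≡ just z → encodeH z ≡ uncurry pair p
decodeH'-sound (0 , r) .(fs r) refl = refl
decodeH'-sound (1 , r) z eq = trans (decodePt-sound (unpair r) z eq) (cong (pair 1) (pair-unpair r))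
decodeH'-sound (suc (suc _) , r) z ()

decodeH-sound : ∀ n z → decodeH n ≡ just z → encodeH z ≡ n
decodeH-sound n z eq = trans (decodeH'-sound (unpair n) z eq) (pair-unpair n)

decodeC'-sound : ∀ p x → decodeC' p ≡ just x → encodeC x ≡ uncurry pair p
decodeC'-sound (0 , r) x eq with decodeH r in e
decodeC'-sound (0 , r) .(base z) refl | just z = cong (pair 0) (decodeH-sound r z e)
decodeC'-sound (1 , r) x eq with unpair r in e1
... | (w , c) with decodeH w in e2
decodeC'-sound (1 , r) .(inC z c) refl | (w , c) | just z =
  cong (pair 1) (trans (cong (λ k → pair k c) (decodeH-sound w z e2))
                       (trans (cong (uncurry pair) (sym e1)) (pair-unpair r)))
decodeC'-sound (suc (suc _) , r) x ()

decodeC-sound : ∀ n x → decodeC n ≡ just x → encodeC x ≡ n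
decodeC-sound n x eq = trans (decodeC'-sound (unpair n) x eq) (pair-unpair n)

encodeC-injective : ∀ x y → encodeC x ≡ encodeC y → x ≡ y
encodeC-injective x y eq = just-injective (trans (sym (decodeC-encodeC x)) (trans (cong decodeC eq) (decodeC-encodeC y)))

infixr 5 _∷₂_
_∷₂_ : Bool → ℕ → ℕ
b ∷₂ s = b2n b + 2 * s

m+2*[1+n]≡2+[m+2*n] : ∀ m n → m + 2 * suc n ≡ suc (suc (m + 2 * n))
m+2*[1+n]≡2+[m+2*n] m n =
  trans (cong (m +_) (*-suc 2 n)) (trans (+-suc m (suc (2 * n))) (cong suc (+-suc m (2 * n))))

bit-∷₂-zero : ∀ b s → bit (b ∷₂ s) 0 ≡ b
bit-∷₂-zero false zero = refl
bit-∷₂-zero true zero = refl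
bit-∷₂-zero b (suc s) = trans (cong (λ x → bit x 0) (m+2*[1+n]≡2+[m+2*n] (b2n b) s)) (bit-∷₂-zero b s)

⌊∷₂/2⌋ : ∀ b s → ⌊ b ∷₂ s /2⌋ ≡ s
⌊∷₂/2⌋ false zero = refl
⌊∷₂/2⌋ true zero = refl
⌊∷₂/2⌋ b (suc s) = trans (cong ⌊_/2⌋ (m+2*[1+n]≡2+[m+2*n] (b2n b) s)) (cong suc (⌊∷₂/2⌋ b s))

bit-∷₂-suc : ∀ b s i → bit (b ∷₂ s) (suc i) ≡ bit s i
bit-∷₂-suc b s i = cong (λ x → bit x i) (⌊∷₂/2⌋ b s)

bit0∷₂⌊/2⌋ : ∀ r → bit r 0 ∷₂ ⌊ r /2⌋ ≡ r
bit0∷₂⌊/2⌋ zero = refl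
bit0∷₂⌊/2⌋ (suc zero) = refl
bit0∷₂⌊/2⌋ (suc (suc r)) =
  trans (m+2*[1+n]≡2+[m+2*n] (b2n (bit r 0)) ⌊ r /2⌋) (cong (λ x → suc (suc x)) (bit0∷₂⌊/2⌋ r))

bit-beyond : ∀ r j → r ≤ j → bit r j ≡ false
bit-beyond zero zero _ = refl
bit-beyond zero (suc j) _ = bit-beyond 0 j z≤n
bit-beyond (suc r) (suc j) (s≤s le) = bit-beyond ⌊ suc r /2⌋ j (≤-trans (s≤s⁻¹ (⌊n/2⌋<n r)) le)

toggle : ℕ → ℕ → ℕ
toggle zero    r = not (bit r 0) ∷₂ ⌊ r /2⌋
toggle (suc k) r = bit r 0 ∷₂ toggle k ⌊ r /2⌋

xor-true : ∀ b → b xor true ≡ not b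
xor-true b = trans (xor-comm b true) (true-xor b)

xor-cancelʳ : ∀ a b → (a xor b) xor b ≡ a
xor-cancelʳ a b = trans (xor-assoc a b b) (trans (cong (a xor_) (xor-same b)) (xor-identityʳ a))

bit-toggle : ∀ k r i → bit (toggle k r) i ≡ bit r i xor (i ≡ᵇ k)
bit-toggle zero r zero = trans (bit-∷₂-zero (not (bit r 0)) ⌊ r /2⌋) (sym (xor-true (bit r 0)))
bit-toggle zero r (suc i) = trans (bit-∷₂-suc (not (bit r 0)) ⌊ r /2⌋ i) (sym (xor-identityʳ _))
bit-toggle (suc k) r zero = trans (bit-∷₂-zero (bit r 0) (toggle k ⌊ r /2⌋)) (sym (xor-identityʳ _))
bit-toggle (suc k) r (suc i) = trans (bit-∷₂-suc (bit r 0) (toggle k ⌊ r /2⌋) i) (bit-toggle k ⌊ r /2⌋ i)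

toggle-involutive : ∀ k r → toggle k (toggle k r) ≡ r
toggle-involutive zero r
  rewrite bit-∷₂-zero (not (bit r 0)) ⌊ r /2⌋ | ⌊∷₂/2⌋ (not (bit r 0)) ⌊ r /2⌋ | not-involutive (bit r 0)
  = bit0∷₂⌊/2⌋ r
toggle-involutive (suc k) r
  rewrite bit-∷₂-zero (bit r 0) (toggle k ⌊ r /2⌋) | ⌊∷₂/2⌋ (bit r 0) (toggle k ⌊ r /2⌋) | toggle-involutive k ⌊ r /2⌋
  = bit0∷₂⌊/2⌋ r

module FoldBelow {A : Set} {_∙_ : A → A → A} {ε : A} (isMonoid : IsMonoid _≡_ _∙_ ε) where
  open IsMonoid isMonoid using (assoc; identityˡ; identityʳ)

  foldBelow : (ℕ → A) → ℕ → A
  foldBelow f zero    = ε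
  foldBelow f (suc N) = foldBelow f N ∙ f N

  foldr-map-upTo : ∀ f N → foldr _∙_ ε (map f (upTo N)) ≡ foldBelow f N
  foldr-map-upTo f zero = refl
  foldr-map-upTo f (suc N) = begin
      foldr _∙_ ε (map f (upTo (suc N)))  ≡⟨ cong (λ l → foldr _∙_ ε (map f l)) (upTo-∷ʳ N) ⟨
      foldr _∙_ ε (map f (upTo N ∷ʳ N))   ≡⟨ cong (foldr _∙_ ε) (map-++ f (upTo N) (N ∷ [])) ⟩
      foldr _∙_ ε (map f (upTo N) ∷ʳ f N) ≡⟨ foldr-∷ʳ _∙_ ε (f N) (map f (upTo N)) ⟩
      foldr _∙_ (f N ∙ ε) (map f (upTo N)) ≡⟨ foldr-∙ (map f (upTo N)) (f N) ⟩
      foldr _∙_ ε (map f (upTo N)) ∙ f N  ≡⟨ cong (_∙ f N) (foldr-map-upTo f N) ⟩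
      foldBelow f N ∙ f N                 ∎
    where
      open ≡-Reasoning
      foldr-∙ : ∀ xs y → foldr _∙_ (y ∙ ε) xs ≡ foldr _∙_ ε xs ∙ y
      foldr-∙ [] y = trans (identityʳ y) (sym (identityˡ y))
      foldr-∙ (x ∷ xs) y = trans (cong (x ∙_) (foldr-∙ xs y)) (sym (assoc x _ y))

  foldBelow-≥ : ∀ f {N M} → N ≤ M → (∀ j → N ≤ j → f j ≡ ε) → foldBelow f M ≡ foldBelow f N
  foldBelow-≥ f {N} N≤M vanish = trans (cong (foldBelow f) (sym (m+[n∸m]≡n N≤M))) (extend _)
    where
      extend : ∀ d → foldBelow f (N + d) ≡ foldBelow f N
      extend zero = cong (foldBelow f) (+-identityʳ N)
      extend (suc d) = begin
          foldBelow f (N + suc d)           ≡⟨ cong (foldBelow f) (+-suc N d) ⟩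
          foldBelow f (N + d) ∙ f (N + d)   ≡⟨ cong (foldBelow f (N + d) ∙_) (vanish (N + d) (m≤m+n N d)) ⟩
          foldBelow f (N + d) ∙ ε           ≡⟨ identityʳ _ ⟩
          foldBelow f (N + d)               ≡⟨ extend d ⟩
          foldBelow f N                     ∎
        where open ≡-Reasoning

  foldBelow-cong : ∀ {f g} N → (∀ j → f j ≡ g j) → foldBelow f N ≡ foldBelow g N
  foldBelow-cong zero f≗g = refl
  foldBelow-cong (suc N) f≗g = cong₂ _∙_ (foldBelow-cong N f≗g) (f≗g N)

open FoldBelow +-0-isMonoid using ()
  renaming (foldBelow to sumBelow; foldr-map-upTo to sum-map-upTo; foldBelow-≥ to sumBelow-≥)
open FoldBelow ∧-isMonoid using ()
  renaming (foldBelow to allBelow; foldr-map-upTo to all-upTo; foldBelow-≥ to allBelow-≥; foldBelow-cong to allBelow-cong)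

popcountBelow : ℕ → ℕ → ℕ
popcountBelow r = sumBelow (λ j → b2n (bit r j))

popcountBelow-≥ : ∀ r N → r ≤ N → popcountBelow r N ≡ popcountBelow r r
popcountBelow-≥ r N r≤N = sumBelow-≥ (λ j → b2n (bit r j)) r≤N (λ j r≤j → cong b2n (bit-beyond r j r≤j))

isEven : ℕ → Bool
isEven zero = true
isEven (suc n) = not (isEven n)

n%2≡ᵇ0≡isEven : ∀ n → (n % 2 ≡ᵇ 0) ≡ isEven n
n%2≡ᵇ0≡isEven zero = refl
n%2≡ᵇ0≡isEven (suc zero) = refl
n%2≡ᵇ0≡isEven (suc (suc n)) = trans (n%2≡ᵇ0≡isEven n) (sym (not-involutive (isEven n)))

evenCard≡isEven-popcountBelow : ∀ r → evenCard r ≡ isEven (popcountBelow r r)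
evenCard≡isEven-popcountBelow r = trans (n%2≡ᵇ0≡isEven (card r)) (cong isEven (sum-map-upTo (λ j → b2n (bit r j)) r))

isEven-+b2n : ∀ a x → isEven (a + b2n x) ≡ isEven a xor x
isEven-+b2n a false = trans (cong isEven (+-identityʳ a)) (sym (xor-identityʳ (isEven a)))
isEven-+b2n a true = trans (cong isEven (+-comm a 1)) (sym (xor-true (isEven a)))

<ᵇ-suc : ∀ k N → (k <ᵇ suc N) ≡ (k <ᵇ N) xor (N ≡ᵇ k)
<ᵇ-suc zero zero = refl
<ᵇ-suc zero (suc N) = refl
<ᵇ-suc (suc k) zero = refl
<ᵇ-suc (suc k) (suc N) = <ᵇ-suc k N

<⇒<ᵇ≡true : ∀ k N → k < N → (k <ᵇ N) ≡ true
<⇒<ᵇ≡true zero (suc N) _ = refl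
<⇒<ᵇ≡true (suc k) (suc N) (s≤s le) = <⇒<ᵇ≡true k N le

xor-interchange : ∀ a b c d → (a xor b) xor (c xor d) ≡ (a xor c) xor (b xor d)
xor-interchange = CommSemigroupProperties.interchange (CommutativeRing.+-commutativeSemigroup xor-∧-commutativeRing)

isEven-popcountBelow-toggle : ∀ k r N → isEven (popcountBelow (toggle k r) N) ≡ isEven (popcountBelow r N) xor (k <ᵇ N)
isEven-popcountBelow-toggle k r zero = refl
isEven-popcountBelow-toggle k r (suc N) = begin
    isEven (popcountBelow r' N + b2n (bit r' N))                   ≡⟨ isEven-+b2n (popcountBelow r' N) (bit r' N) ⟩
    isEven (popcountBelow r' N) xor bit r' N                       ≡⟨ cong₂ _xor_ (isEven-popcountBelow-toggle k r N) (bit-toggle k r N) ⟩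
    (isEven (popcountBelow r N) xor (k <ᵇ N)) xor (bit r N xor (N ≡ᵇ k)) ≡⟨ xor-interchange (isEven (popcountBelow r N)) (k <ᵇ N) (bit r N) (N ≡ᵇ k) ⟩
    (isEven (popcountBelow r N) xor bit r N) xor ((k <ᵇ N) xor (N ≡ᵇ k)) ≡⟨ cong₂ _xor_ (isEven-+b2n (popcountBelow r N) (bit r N)) (<ᵇ-suc k N) ⟨
    isEven (popcountBelow r N + b2n (bit r N)) xor (k <ᵇ suc N)    ∎
  where
    open ≡-Reasoning
    r' : ℕ
    r' = toggle k r

evenCard-toggle : ∀ k r → evenCard (toggle k r) ≡ not (evenCard r)
evenCard-toggle k r = begin
    evenCard r'                               ≡⟨ evenCard≡isEven-popcountBelow r' ⟩
    isEven (popcountBelow r' r')              ≡⟨ cong isEven (popcountBelow-≥ r' N r'≤N) ⟨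
    isEven (popcountBelow r' N)               ≡⟨ isEven-popcountBelow-toggle k r N ⟩
    isEven (popcountBelow r N) xor (k <ᵇ N)   ≡⟨ cong (isEven (popcountBelow r N) xor_) (<⇒<ᵇ≡true k N k<N) ⟩
    isEven (popcountBelow r N) xor true       ≡⟨ xor-true _ ⟩
    not (isEven (popcountBelow r N))          ≡⟨ cong (not ∘ isEven) (popcountBelow-≥ r N r≤N) ⟩
    not (isEven (popcountBelow r r))          ≡⟨ cong not (evenCard≡isEven-popcountBelow r) ⟨
    not (evenCard r)                          ∎
  where
    open ≡-Reasoning
    r' : ℕ
    r' = toggle k r
    N : ℕ
    N = r + r' + suc k
    r≤N : r ≤ N
    r≤N = ≤-trans (m≤m+n r r') (m≤m+n (r + r') (suc k))
    r'≤N : r' ≤ N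
    r'≤N = ≤-trans (m≤n+m r' r) (m≤m+n (r + r') (suc k))
    k<N : k < N
    k<N = m≤n+m (suc k) (r + r')

symDiffAt : ℕ → ℕ → ℕ → ℕ → Bool
symDiffAt r s i j = not ((bit r j xor bit s j) xor (j ≡ᵇ i))

<⇒≡ᵇ≡false : ∀ j i → i < j → (j ≡ᵇ i) ≡ false
<⇒≡ᵇ≡false (suc j) zero _ = refl
<⇒≡ᵇ≡false (suc j) (suc i) (s≤s le) = <⇒≡ᵇ≡false j i le

symDiffAt-beyond : ∀ r s i j → suc (r + s + i) ≤ j → symDiffAt r s i j ≡ true
symDiffAt-beyond r s i j le
  rewrite bit-beyond r j (≤-trans (≤-trans (m≤m+n r s) (m≤m+n (r + s) i)) (≤-trans (n≤1+n _) le))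
        | bit-beyond s j (≤-trans (≤-trans (m≤n+m s r) (m≤m+n (r + s) i)) (≤-trans (n≤1+n _) le))
        | <⇒≡ᵇ≡false j i (≤-trans (s≤s (m≤n+m i (r + s))) le) = refl

symDiffIs≡allBelow : ∀ r s i M → suc (r + s + i) ≤ M → symDiffIs r s i ≡ allBelow (symDiffAt r s i) M
symDiffIs≡allBelow r s i M le =
  trans (all-upTo (symDiffAt r s i) (suc (r + s + i))) (sym (allBelow-≥ (symDiffAt r s i) le (symDiffAt-beyond r s i)))

xor-cancel-common : ∀ a b c → (a xor c) xor (b xor c) ≡ a xor b
xor-cancel-common a b c = trans (xor-interchange a c b c) (trans (cong ((a xor b) xor_) (xor-same c)) (xor-identityʳ _))

symDiffIs-toggle : ∀ k r s i → symDiffIs (toggle k r) (toggle k s) i ≡ symDiffIs r s i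
symDiffIs-toggle k r s i = begin
    symDiffIs r' s' i              ≡⟨ symDiffIs≡allBelow r' s' i M (m≤m+n _ _) ⟩
    allBelow (symDiffAt r' s' i) M ≡⟨ allBelow-cong M symDiffAt-toggle ⟩
    allBelow (symDiffAt r s i) M   ≡⟨ symDiffIs≡allBelow r s i M (m≤n+m _ (suc (r' + s' + i))) ⟨
    symDiffIs r s i                ∎
  where
    open ≡-Reasoning
    r' : ℕ
    r' = toggle k r
    s' : ℕ
    s' = toggle k s
    M : ℕ
    M = suc (r' + s' + i) + suc (r + s + i)
    symDiffAt-toggle : ∀ j → symDiffAt r' s' i j ≡ symDiffAt r s i j
    symDiffAt-toggle j rewrite bit-toggle k r j | bit-toggle k s j | xor-cancel-common (bit r j) (bit s j) (j ≡ᵇ k) = refl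

-- The relations of a composite structure as functions of the decoded arguments
-- (Defs defines them by `with` on decodeC; these versions can be rewritten along equations for decodeC)

DomDecoded : (HElt → Str) → Maybe CElt → Bool
DomDecoded C (just (base _)) = true
DomDecoded C (just (inC z c)) = Dom (C z) c
DomDecoded C nothing = false

CompDom-decoded : ∀ C n → CompDom C n ≡ DomDecoded C (decodeC n)
CompDom-decoded C n with decodeC n
... | just (base _) = refl
... | just (inC z c) = refl
... | nothing = refl

ERelDecoded : ℕ → Maybe CElt → Maybe CElt → Bool
ERelDecoded i (just (base (fs r))) (just (base (fs s))) = symDiffIs r s i
ERelDecoded i _ _ = false

ERel-decoded : ∀ i u v → ERel i (u ∷ v ∷ []) ≡ ERelDecoded i (decodeC u) (decodeC v)
ERel-decoded i u v with decodeC u | decodeC v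
... | nothing | _ = refl
... | just (base (pt _ _)) | _ = refl
... | just (inC _ _) | _ = refl
... | just (base (fs r)) | nothing = refl
... | just (base (fs r)) | just (base (pt _ _)) = refl
... | just (base (fs r)) | just (inC _ _) = refl
... | just (base (fs r)) | just (base (fs s)) = refl

DRelDecoded : ℕ → Maybe CElt → Maybe CElt → Bool
DRelDecoded i (just (base (fs r))) (just (base (pt j a))) = (j ≡ᵇ i) ∧ eqB (bit r i) a
DRelDecoded i _ _ = false

DRel-decoded : ∀ i u v → DRel i (u ∷ v ∷ []) ≡ DRelDecoded i (decodeC u) (decodeC v)
DRel-decoded i u v with decodeC u | decodeC v
... | nothing | _ = refl
... | just (base (pt _ _)) | _ = refl
... | just (inC _ _) | _ = refl
... | just (base (fs r)) | nothing = refl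
... | just (base (fs r)) | just (base (pt _ _)) = refl
... | just (base (fs r)) | just (inC _ _) = refl
... | just (base (fs r)) | just (base (fs s)) = refl

MuDecoded : Maybe CElt → Maybe CElt → Bool
MuDecoded (just (inC z c)) (just (base z')) = eqH z z'
MuDecoded (just (base z)) (just (base z')) = eqH z z'
MuDecoded _ _ = false

MuRel-decoded : ∀ u v → MuRel (u ∷ v ∷ []) ≡ MuDecoded (decodeC u) (decodeC v)
MuRel-decoded u v with decodeC u | decodeC v
... | nothing | _ = refl
... | just (base _) | nothing = refl
... | just (base _) | just (base _) = refl
... | just (base _) | just (inC _ _) = refl
... | just (inC _ _) | nothing = refl
... | just (inC _ _) | just (base _) = refl
... | just (inC _ _) | just (inC _ _) = refl

collectStep : HElt → Maybe CElt → Maybe (List ℕ) → Maybe (List ℕ)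
collectStep z (just (inC z' c)) (just cs) = if eqH z z' then just (c ∷ cs) else nothing
collectStep z _ _ = nothing

collect-∷ : ∀ z u us → collect z (u ∷ us) ≡ collectStep z (decodeC u) (collect z us)
collect-∷ z u us with decodeC u | collect z us
... | nothing | _ = refl
... | just (base _) | _ = refl
... | just (inC z' c) | nothing = refl
... | just (inC z' c) | just cs with eqH z z'
... | true = refl
... | false = refl

RelOfCollected : (HElt → Str) → ℕ → HElt → Maybe (List ℕ) → Bool
RelOfCollected C k z (just cs) = Rel (C z) k cs
RelOfCollected C k z nothing = false

CRelDecoded : (HElt → Str) → ℕ → Maybe CElt → List ℕ → Bool
CRelDecoded C k (just (inC z c)) l = RelOfCollected C k z (collect z l)
CRelDecoded C k _ l = false

CRel-decoded : ∀ C k u us → CRel C k (u ∷ us) ≡ CRelDecoded C k (decodeC u) (u ∷ us)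
CRel-decoded C k u us with decodeC u
... | nothing = refl
... | just (base _) = refl
... | just (inC z c) with collect z (u ∷ us)
... | just cs = refl
... | nothing = refl

≡ᵇ-true⇒≡ : ∀ m n → (m ≡ᵇ n) ≡ true → m ≡ n
≡ᵇ-true⇒≡ zero zero _ = refl
≡ᵇ-true⇒≡ zero (suc n) ()
≡ᵇ-true⇒≡ (suc m) zero ()
≡ᵇ-true⇒≡ (suc m) (suc n) e = cong suc (≡ᵇ-true⇒≡ m n e)

≡ᵇ-refl : ∀ m → (m ≡ᵇ m) ≡ true
≡ᵇ-refl zero = refl
≡ᵇ-refl (suc m) = ≡ᵇ-refl m

eqH-refl : ∀ z → eqH z z ≡ true
eqH-refl (fs r) = ≡ᵇ-refl r
eqH-refl (pt i false) rewrite ≡ᵇ-refl i = refl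
eqH-refl (pt i true) rewrite ≡ᵇ-refl i = refl

eqH-refl≢false : ∀ z → eqH z z ≡ false → ⊥
eqH-refl≢false z p with trans (sym (eqH-refl z)) p
... | ()

∧-true⇒ : ∀ a b → (a ∧ b) ≡ true → (a ≡ true) × (b ≡ true)
∧-true⇒ true true _ = refl , refl
∧-true⇒ true false ()
∧-true⇒ false b ()

eqB-true⇒≡ : ∀ a b → eqB a b ≡ true → a ≡ b
eqB-true⇒≡ false false _ = refl
eqB-true⇒≡ true true _ = refl
eqB-true⇒≡ false true ()
eqB-true⇒≡ true false ()

eqH-true⇒≡ : ∀ z z' → eqH z z' ≡ true → z ≡ z'
eqH-true⇒≡ (fs r) (fs s) e = cong fs (≡ᵇ-true⇒≡ r s e)
eqH-true⇒≡ (pt i a) (pt j b) e with ∧-true⇒ (i ≡ᵇ j) (eqB a b) e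
... | e1 , e2 = cong₂ pt (≡ᵇ-true⇒≡ i j e1) (eqB-true⇒≡ a b e2)
eqH-true⇒≡ (fs _) (pt _ _) ()
eqH-true⇒≡ (pt _ _) (fs _) ()

pointOf : CElt → HElt
pointOf (base z) = z
pointOf (inC z _) = z

eltOf : CElt → ℕ
eltOf (base _) = 0
eltOf (inC _ c) = c

InDomC : (HElt → Str) → ℕ → Set
InDomC C n = InDom (composite C) n

InDom-decode : ∀ C n → InDomC C n → Σ CElt λ x → (decodeC n ≡ just x) × (DomDecoded C (just x) ≡ true)
InDom-decode C n d = dd (decodeC n) (trans (sym (CompDom-decoded C n)) d)
  where
    dd : ∀ (m : Maybe CElt) → DomDecoded C m ≡ true → Σ CElt λ x → (m ≡ just x) × (DomDecoded C (just x) ≡ true)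
    dd (just x) p = x , refl , p
    dd nothing ()

-- Relabelling a composite structure along a permutation σ of H

iso-InDom : ∀ {S T f} → IsIso S T f → ∀ a → InDom S a → InDom T (f a)
iso-InDom = proj₁

iso-injective : ∀ {S T f} → IsIso S T f → ∀ a a' → InDom S a → InDom S a' → f a ≡ f a' → a ≡ a'
iso-injective = proj₁ ∘ proj₂

iso-surjective : ∀ {S T f} → IsIso S T f → ∀ b → InDom T b → Σ ℕ λ a → InDom S a × f a ≡ b
iso-surjective = proj₁ ∘ proj₂ ∘ proj₂

iso-Rel : ∀ {S T f} → IsIso S T f → ∀ k xs → All (InDom S) xs → Rel S k xs ≡ Rel T k (map f xs)
iso-Rel = proj₂ ∘ proj₂ ∘ proj₂

module Relabelling (C C' : HElt → Str) (σfs : ℕ → ℕ) (σpt : ℕ → Bool → Bool) (h : HElt → ℕ → ℕ) where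

  σ : HElt → HElt
  σ (fs r) = fs (σfs r)
  σ (pt j a) = pt j (σpt j a)

  relabelElt : CElt → CElt
  relabelElt (base z) = base (σ z)
  relabelElt (inC z c) = inC (σ z) (h z c)

  relabelDecoded : Maybe CElt → ℕ
  relabelDecoded (just x) = encodeC (relabelElt x)
  relabelDecoded nothing = 0

  relabel : ℕ → ℕ
  relabel n = relabelDecoded (decodeC n)

  relabel-decode : ∀ n x → decodeC n ≡ just x → relabel n ≡ encodeC (relabelElt x)
  relabel-decode n x e rewrite e = refl

  decodeC-relabel : ∀ n x → decodeC n ≡ just x → decodeC (relabel n) ≡ just (relabelElt x)
  decodeC-relabel n x e = trans (cong decodeC (relabel-decode n x e)) (decodeC-encodeC (relabelElt x))

  module Isomorphism
    (σfs-involutive : ∀ r → σfs (σfs r) ≡ r)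
    (σpt-involutive : ∀ j a → σpt j (σpt j a) ≡ a)
    (σfs-symDiffIs : ∀ r s i → symDiffIs (σfs r) (σfs s) i ≡ symDiffIs r s i)
    (σ-DRel : ∀ r i j a → ((j ≡ᵇ i) ∧ eqB (bit (σfs r) i) (σpt j a)) ≡ ((j ≡ᵇ i) ∧ eqB (bit r i) a))
    (fibreIso : ∀ z → IsIso (C z) (C' (σ z)) (h z)) where

    σ-involutive : ∀ z → σ (σ z) ≡ z
    σ-involutive (fs r) = cong fs (σfs-involutive r)
    σ-involutive (pt j a) = cong (pt j) (σpt-involutive j a)

    σ-injective : ∀ z z' → σ z ≡ σ z' → z ≡ z'
    σ-injective z z' e = trans (sym (σ-involutive z)) (trans (cong σ e) (σ-involutive z'))

    eqH-σ : ∀ z z' → eqH (σ z) (σ z') ≡ eqH z z'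
    eqH-σ z z' with eqH z z' in e | eqH (σ z) (σ z') in e'
    ... | true  | true  = refl
    ... | false | false = refl
    ... | true  | false with eqH-true⇒≡ z z' e
    ...   | refl = ⊥-elim (eqH-refl≢false (σ z) e')
    eqH-σ z z' | false | true with σ-injective z z' (eqH-true⇒≡ (σ z) (σ z') e')
    ...   | refl = ⊥-elim (eqH-refl≢false z e)

    relabelElt-Dom : ∀ x → DomDecoded C (just x) ≡ true → DomDecoded C' (just (relabelElt x)) ≡ true
    relabelElt-Dom (base z) _ = refl
    relabelElt-Dom (inC z c) d = iso-InDom {C z} {C' (σ z)} (fibreIso z) c d

    relabel-InDom : ∀ n → InDomC C n → InDomC C' (relabel n)
    relabel-InDom n d with InDom-decode C n d
    ... | x , e , dx = trans (CompDom-decoded C' (relabel n)) (trans (cong (DomDecoded C') (decodeC-relabel n x e)) (relabelElt-Dom x dx))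

    relabelElt-injective : ∀ x y → DomDecoded C (just x) ≡ true → DomDecoded C (just y) ≡ true → relabelElt x ≡ relabelElt y → x ≡ y
    relabelElt-injective (base z) (base z') _ _ e = cong base (σ-injective z z' (cong pointOf e))
    relabelElt-injective (inC z c) (inC z' c') dx dy e with σ-injective z z' (cong pointOf e)
    ... | refl = cong (inC z) (iso-injective {C z} {C' (σ z)} (fibreIso z) c c' dx dy (cong eltOf e))
    relabelElt-injective (base _) (inC _ _) _ _ ()
    relabelElt-injective (inC _ _) (base _) _ _ ()

    relabel-injective : ∀ n n' → InDomC C n → InDomC C n' → relabel n ≡ relabel n' → n ≡ n'
    relabel-injective n n' d d' e with InDom-decode C n d | InDom-decode C n' d'
    ... | x , ex , dx | y , ey , dy =
      trans (sym (decodeC-sound n x ex))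
        (trans (cong encodeC (relabelElt-injective x y dx dy (encodeC-injective (relabelElt x) (relabelElt y)
            (trans (sym (relabel-decode n x ex)) (trans e (relabel-decode n' y ey))))))
          (decodeC-sound n' y ey))

    relabel-surjective : ∀ b → InDomC C' b → Σ ℕ λ a → InDomC C a × relabel a ≡ b
    relabel-surjective b d with InDom-decode C' b d
    ... | base w , eb , _ =
      encodeC (base (σ w)) ,
      trans (CompDom-decoded C (encodeC (base (σ w)))) (cong (DomDecoded C) (decodeC-encodeC (base (σ w)))) ,
      trans (relabel-decode (encodeC (base (σ w))) (base (σ w)) (decodeC-encodeC (base (σ w))))
        (trans (cong (λ v → encodeC (base v)) (σ-involutive w)) (decodeC-sound b (base w) eb))
    ... | inC w c , eb , dc with iso-surjective {C (σ w)} {C' (σ (σ w))} (fibreIso (σ w)) c (subst (λ v → Dom (C' v) c ≡ true) (sym (σ-involutive w)) dc)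
    ... | a0 , da0 , ha0 =
      encodeC (inC (σ w) a0) ,
      trans (CompDom-decoded C (encodeC (inC (σ w) a0))) (trans (cong (DomDecoded C) (decodeC-encodeC (inC (σ w) a0))) da0) ,
      trans (relabel-decode (encodeC (inC (σ w) a0)) (inC (σ w) a0) (decodeC-encodeC (inC (σ w) a0)))
        (trans (cong₂ (λ v u → encodeC (inC v u)) (σ-involutive w) ha0) (decodeC-sound b (inC w c) eb))

    ERelDecoded-relabelElt : ∀ i x y → ERelDecoded i (just (relabelElt x)) (just (relabelElt y)) ≡ ERelDecoded i (just x) (just y)
    ERelDecoded-relabelElt i (base (fs r)) (base (fs s)) = σfs-symDiffIs r s i
    ERelDecoded-relabelElt i (base (fs r)) (base (pt _ _)) = refl
    ERelDecoded-relabelElt i (base (fs r)) (inC _ _) = refl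
    ERelDecoded-relabelElt i (base (pt _ _)) _ = refl
    ERelDecoded-relabelElt i (inC _ _) _ = refl

    DRelDecoded-relabelElt : ∀ i x y → DRelDecoded i (just (relabelElt x)) (just (relabelElt y)) ≡ DRelDecoded i (just x) (just y)
    DRelDecoded-relabelElt i (base (fs r)) (base (pt j a)) = σ-DRel r i j a
    DRelDecoded-relabelElt i (base (fs r)) (base (fs _)) = refl
    DRelDecoded-relabelElt i (base (fs r)) (inC _ _) = refl
    DRelDecoded-relabelElt i (base (pt _ _)) _ = refl
    DRelDecoded-relabelElt i (inC _ _) _ = refl

    MuDecoded-relabelElt : ∀ x y → MuDecoded (just (relabelElt x)) (just (relabelElt y)) ≡ MuDecoded (just x) (just y)
    MuDecoded-relabelElt (base z) (base z') = eqH-σ z z'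
    MuDecoded-relabelElt (inC z c) (base z') = eqH-σ z z'
    MuDecoded-relabelElt (base z) (inC _ _) = refl
    MuDecoded-relabelElt (inC z c) (inC _ _) = refl

    decode-relabel : ∀ u → InDomC C u → Σ CElt λ x → (decodeC u ≡ just x) × (decodeC (relabel u) ≡ just (relabelElt x))
    decode-relabel u d with InDom-decode C u d
    ... | x , e , _ = x , e , decodeC-relabel u x e

    binaryRel-relabel : (R : List ℕ → Bool) (R̂ : Maybe CElt → Maybe CElt → Bool) →
                        (∀ u v → R (u ∷ v ∷ []) ≡ R̂ (decodeC u) (decodeC v)) →
                        (∀ x y → R̂ (just (relabelElt x)) (just (relabelElt y)) ≡ R̂ (just x) (just y)) →
                        ∀ u v → InDomC C u → InDomC C v → R (u ∷ v ∷ []) ≡ R (relabel u ∷ relabel v ∷ [])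
    binaryRel-relabel R R̂ R-decoded R̂-relabelElt u v du dv
      with decode-relabel u du | decode-relabel v dv
    ... | x , ex , fx | y , ey , fy = begin
        R (u ∷ v ∷ [])                                ≡⟨ R-decoded u v ⟩
        R̂ (decodeC u) (decodeC v)                     ≡⟨ cong₂ R̂ ex ey ⟩
        R̂ (just x) (just y)                           ≡⟨ R̂-relabelElt x y ⟨
        R̂ (just (relabelElt x)) (just (relabelElt y)) ≡⟨ cong₂ R̂ fx fy ⟨
        R̂ (decodeC (relabel u)) (decodeC (relabel v)) ≡⟨ R-decoded (relabel u) (relabel v) ⟨
        R (relabel u ∷ relabel v ∷ [])                ∎
      where open ≡-Reasoning

    ERel-relabel : ∀ i xs → All (InDomC C) xs → ERel i xs ≡ ERel i (map relabel xs)
    ERel-relabel i [] _ = refl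
    ERel-relabel i (u ∷ []) _ = refl
    ERel-relabel i (u ∷ v ∷ w ∷ ws) _ = refl
    ERel-relabel i (u ∷ v ∷ []) (du ∷ dv ∷ []) =
      binaryRel-relabel (ERel i) (ERelDecoded i) (ERel-decoded i) (ERelDecoded-relabelElt i) u v du dv

    DRel-relabel : ∀ i xs → All (InDomC C) xs → DRel i xs ≡ DRel i (map relabel xs)
    DRel-relabel i [] _ = refl
    DRel-relabel i (u ∷ []) _ = refl
    DRel-relabel i (u ∷ v ∷ w ∷ ws) _ = refl
    DRel-relabel i (u ∷ v ∷ []) (du ∷ dv ∷ []) =
      binaryRel-relabel (DRel i) (DRelDecoded i) (DRel-decoded i) (DRelDecoded-relabelElt i) u v du dv

    MuRel-relabel : ∀ xs → All (InDomC C) xs → MuRel xs ≡ MuRel (map relabel xs)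
    MuRel-relabel [] _ = refl
    MuRel-relabel (u ∷ []) _ = refl
    MuRel-relabel (u ∷ v ∷ w ∷ ws) _ = refl
    MuRel-relabel (u ∷ v ∷ []) (du ∷ dv ∷ []) =
      binaryRel-relabel MuRel MuDecoded MuRel-decoded MuDecoded-relabelElt u v du dv

    collect-relabel : ∀ z xs → All (InDomC C) xs → collect (σ z) (map relabel xs) ≡ mapM (map (h z)) (collect z xs)
    collect-relabel z [] _ = refl
    collect-relabel z (u ∷ us) (du ∷ dus) with decode-relabel u du
    ... | x , ex , fx =
      trans (collect-∷ (σ z) (relabel u) (map relabel us))
        (trans (cong₂ (collectStep (σ z)) fx (collect-relabel z us dus))
          (trans (step x (collect z us)) (cong (mapM (map (h z))) (sym (trans (collect-∷ z u us) (cong (λ m → collectStep z m (collect z us)) ex))))))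
      where
        step : ∀ x m → collectStep (σ z) (just (relabelElt x)) (mapM (map (h z)) m) ≡ mapM (map (h z)) (collectStep z (just x) m)
        step (base _) m = refl
        step (inC z' c) nothing = refl
        step (inC z' c) (just cs) rewrite eqH-σ z z' with eqH z z' in e
        ... | true rewrite eqH-true⇒≡ z z' e = refl
        ... | false = refl

    collect-Dom : ∀ z xs cs → All (InDomC C) xs → collect z xs ≡ just cs → All (λ c → Dom (C z) c ≡ true) cs
    collect-Dom z [] .[] _ refl = []
    collect-Dom z (u ∷ us) cs (du ∷ dus) e with InDom-decode C u du
    ... | x , ex , dx = go x (collect z us) (λ cs' → collect-Dom z us cs' dus) dx (trans (sym (cong (λ m → collectStep z m (collect z us)) ex)) (trans (sym (collect-∷ z u us)) e))
      where
        go : ∀ x m → (∀ cs' → m ≡ just cs' → All (λ c → Dom (C z) c ≡ true) cs') → DomDecoded C (just x) ≡ true →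
             collectStep z (just x) m ≡ just cs → All (λ c → Dom (C z) c ≡ true) cs
        go (base _) m _ _ ()
        go (inC z' c) nothing _ _ ()
        go (inC z' c) (just cs') ih dc e2 with eqH z z' in ez
        go (inC z' c) (just cs') ih dc refl | true rewrite eqH-true⇒≡ z z' ez = dc ∷ ih cs' refl
        go (inC z' c) (just cs') ih dc () | false

    CRel-relabel : ∀ k xs → All (InDomC C) xs → CRel C k xs ≡ CRel C' k (map relabel xs)
    CRel-relabel k [] _ = refl
    CRel-relabel k (u ∷ us) ds@(du ∷ dus) with decode-relabel u du
    ... | x , ex , fx =
      trans (CRel-decoded C k u us) (trans (cong (λ m → CRelDecoded C k m (u ∷ us)) ex)
        (trans (go x refl) (sym (trans (CRel-decoded C' k (relabel u) (map relabel us)) (cong (λ m → CRelDecoded C' k m (relabel u ∷ map relabel us)) fx)))))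
      where
        go2 : ∀ z m → (∀ cs → m ≡ just cs → All (λ c → Dom (C z) c ≡ true) cs) →
              RelOfCollected C k z m ≡ RelOfCollected C' k (σ z) (mapM (map (h z)) m)
        go2 z nothing _ = refl
        go2 z (just cs) dd = iso-Rel {C z} {C' (σ z)} (fibreIso z) k cs (dd cs refl)
        go : ∀ y → y ≡ x → CRelDecoded C k (just y) (u ∷ us) ≡ CRelDecoded C' k (just (relabelElt y)) (relabel u ∷ map relabel us)
        go (base _) _ = refl
        go (inC z c) _ = trans (go2 z (collect z (u ∷ us)) (λ cs e → collect-Dom z (u ∷ us) cs ds e))
                               (cong (RelOfCollected C' k (σ z)) (sym (collect-relabel z (u ∷ us) ds)))

    HSym-relabel : ∀ p xs → All (InDomC C) xs → HSym p xs ≡ HSym p (map relabel xs)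
    HSym-relabel (0 , i) xs ds = ERel-relabel i xs ds
    HSym-relabel (1 , i) xs ds = DRel-relabel i xs ds
    HSym-relabel (suc (suc _) , i) xs ds = refl

    CompRel-relabel : ∀ p xs → All (InDomC C) xs → CompRel' C p xs ≡ CompRel' C' p (map relabel xs)
    CompRel-relabel (0 , k) xs ds = HSym-relabel (unpair k) xs ds
    CompRel-relabel (1 , _) xs ds = MuRel-relabel xs ds
    CompRel-relabel (2 , k) xs ds = CRel-relabel k xs ds
    CompRel-relabel (suc (suc (suc _)) , _) xs ds = refl

    relabel-isIso : IsIso (composite C) (composite C') relabel
    relabel-isIso = relabel-InDom , relabel-injective , relabel-surjective , (λ k xs ds → CompRel-relabel (unpair k) xs ds)

Computes : ∀ {n} → PR n → (Vec ℕ n → ℕ) → Set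
Computes e F = ∀ {X} xs → X ⊢ e [ xs ]⇓ F xs

Computes₁ : PR 1 → (ℕ → ℕ) → Set
Computes₁ e F = ∀ {X} x → X ⊢ e [ x ∷ [] ]⇓ F x

Computes₂ : PR 2 → (ℕ → ℕ → ℕ) → Set
Computes₂ e F = ∀ {X} x y → X ⊢ e [ x ∷ y ∷ [] ]⇓ F x y

⇓-conv : ∀ {X n} {e : PR n} {xs y y'} → y ≡ y' → X ⊢ e [ xs ]⇓ y → X ⊢ e [ xs ]⇓ y'
⇓-conv refl d = d

c1 : ∀ {n} → PR 1 → PR n → PR n
c1 f a = comp f (a ∷ [])

c2 : ∀ {n} → PR 2 → PR n → PR n → PR n
c2 f a b = comp f (a ∷ b ∷ [])

c1-computes : ∀ {n} {f : PR 1} {a : PR n} {F A} → Computes₁ f F → Computes a A → Computes (c1 f a) (λ xs → F (A xs))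
c1-computes tf ta xs = ecomp (ta xs ∷ []) (tf _)

c2-computes : ∀ {n} {f : PR 2} {a b : PR n} {F A B} → Computes₂ f F → Computes a A → Computes b B →
              Computes (c2 f a b) (λ xs → F (A xs) (B xs))
c2-computes tf ta tb xs = ecomp (ta xs ∷ tb xs ∷ []) (tf _ _)

constP : ∀ {n} → ℕ → PR n
constP zero = zer
constP (suc k) = c1 sc (constP k)

constP-computes : ∀ {n} k → Computes {n} (constP k) (λ _ → k)
constP-computes zero xs = ezer
constP-computes (suc k) xs = ecomp (constP-computes k xs ∷ []) esc

prj-computes : ∀ {n} (i : Fin n) → Computes (prj i) (λ xs → lookup xs i)
prj-computes i xs = eprj

addP : PR 2
addP = prec (prj zero) (c1 sc (prj (suc zero)))

addP-computes : Computes₂ addP _+_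
addP-computes zero y = eprec0 eprj
addP-computes (suc x) y = eprecS (addP-computes x y) (ecomp (eprj ∷ []) esc)

predP : PR 1
predP = prec zer (prj zero)

predP-computes : Computes₁ predP pred
predP-computes zero = eprec0 ezer
predP-computes (suc x) = eprecS (predP-computes x) eprj

monusP : PR 2
monusP = prec (prj zero) (c1 predP (prj (suc zero)))

monusP-computes : Computes₂ monusP (λ y x → x ∸ y)
monusP-computes zero x = eprec0 eprj
monusP-computes (suc y) x =
  ⇓-conv (pred[m∸n]≡m∸[1+n] x y) (eprecS (monusP-computes y x) (ecomp (eprj ∷ []) (predP-computes _)))

subP : PR 2
subP = c2 monusP (prj (suc zero)) (prj zero)

subP-computes : Computes₂ subP _∸_
subP-computes x y = ecomp (eprj ∷ eprj ∷ []) (monusP-computes y x)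

mulP : PR 2
mulP = prec zer (c2 addP (prj (suc zero)) (prj (suc (suc zero))))

mulP-computes : Computes₂ mulP _*_
mulP-computes zero y = eprec0 ezer
mulP-computes (suc x) y =
  ⇓-conv (+-comm (x * y) y) (eprecS (mulP-computes x y) (ecomp (eprj ∷ eprj ∷ []) (addP-computes _ _)))

isZero : ℕ → ℕ
isZero x = b2n (x ≡ᵇ 0)

isZeroP : PR 1
isZeroP = prec (constP 1) zer

isZeroP-computes : Computes₁ isZeroP isZero
isZeroP-computes zero = eprec0 (constP-computes 1 [])
isZeroP-computes (suc x) = eprecS (isZeroP-computes x) ezer

eqNat : ℕ → ℕ → ℕ
eqNat x y = b2n (x ≡ᵇ y)

eqP : PR 2
eqP = c1 isZeroP (c2 addP (c2 subP (prj zero) (prj (suc zero))) (c2 subP (prj (suc zero)) (prj zero)))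

eqP-computes : Computes₂ eqP eqNat
eqP-computes x y = ⇓-conv (cong b2n ([m∸n]+[n∸m]≡ᵇ0 x y))
  (c1-computes isZeroP-computes
    (c2-computes addP-computes (c2-computes subP-computes (prj-computes zero) (prj-computes (suc zero)))
                               (c2-computes subP-computes (prj-computes (suc zero)) (prj-computes zero)))
    (x ∷ y ∷ []))
  where
    [m∸n]+[n∸m]≡ᵇ0 : ∀ m n → ((m ∸ n) + (n ∸ m) ≡ᵇ 0) ≡ (m ≡ᵇ n)
    [m∸n]+[n∸m]≡ᵇ0 zero zero = refl
    [m∸n]+[n∸m]≡ᵇ0 zero (suc n) = refl
    [m∸n]+[n∸m]≡ᵇ0 (suc m) zero = cong (_≡ᵇ 0) (+-identityʳ (suc m))
    [m∸n]+[n∸m]≡ᵇ0 (suc m) (suc n) = [m∸n]+[n∸m]≡ᵇ0 m n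

select : ℕ → ℕ → ℕ → ℕ
select zero a b = a
select (suc _) a b = b

selectP : ∀ {n} → PR n → PR n → PR n → PR n
selectP c a b = comp (prec (prj zero) (prj (suc (suc (suc zero))))) (c ∷ a ∷ b ∷ [])

selectP-⇓ : ∀ {X n} {c a b : PR n} {xs C A B} → X ⊢ c [ xs ]⇓ C → X ⊢ a [ xs ]⇓ A → X ⊢ b [ xs ]⇓ B →
            X ⊢ selectP c a b [ xs ]⇓ select C A B
selectP-⇓ {C = C} dc da db = ecomp (dc ∷ da ∷ db ∷ []) (by-cases C)
  where
    by-cases : ∀ {X} k → X ⊢ prec (prj zero) (prj (suc (suc (suc zero)))) [ k ∷ _ ∷ _ ∷ [] ]⇓ select k _ _
    by-cases zero = eprec0 eprj
    by-cases (suc k) = eprecS (by-cases k) eprj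

triangleP : PR 1
triangleP = prec zer (c2 addP (c1 sc (prj zero)) (prj (suc zero)))

triangleP-computes : Computes₁ triangleP triangle
triangleP-computes zero = eprec0 ezer
triangleP-computes (suc k) = eprecS (triangleP-computes k) (ecomp (ecomp (eprj ∷ []) esc ∷ eprj ∷ []) (addP-computes _ _))

pairP : PR 2
pairP = c2 addP (c1 triangleP (c2 addP (prj zero) (prj (suc zero)))) (prj (suc zero))

pairP-computes : Computes₂ pairP pair
pairP-computes x y =
  c2-computes addP-computes (c1-computes triangleP-computes (c2-computes addP-computes (prj-computes zero) (prj-computes (suc zero))))
    (prj-computes (suc zero)) (x ∷ y ∷ [])

diagonal : ℕ → ℕ
diagonal n = unpair₁ n + unpair₂ n

-- diagonal n is the least d with n < triangle (suc d), found by unbounded search.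
diagonalTestP : PR 2
diagonalTestP = c2 subP (c1 sc (prj (suc zero))) (c1 triangleP (c1 sc (prj zero)))

diagonalP : PR 1
diagonalP = mu diagonalTestP

diagonalP-computes : Computes₁ diagonalP diagonal
diagonalP-computes {X} n = emu (⇓-conv found (test (diagonal n))) below
  where
    test : ∀ d → X ⊢ diagonalTestP [ d ∷ n ∷ [] ]⇓ (suc n ∸ triangle (suc d))
    test d = ecomp (ecomp (eprj ∷ []) esc ∷ ecomp (ecomp (eprj ∷ []) esc ∷ []) (triangleP-computes _) ∷ []) (subP-computes _ _)
    s : ℕ
    s = diagonal n
    b : ℕ
    b = unpair₂ n
    found : suc n ∸ triangle (suc s) ≡ 0
    found = m≤n⇒m∸n≡0 (begin
      suc n                   ≡⟨ cong suc (pair-unpair n) ⟨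
      suc (triangle s + b)    ≤⟨ s≤s (+-monoʳ-≤ (triangle s) (m≤n+m b (unpair₁ n))) ⟩
      suc (triangle s + s)    ≡⟨ cong suc (+-comm (triangle s) s) ⟩
      triangle (suc s)        ∎)
      where open ≤-Reasoning
    below : ∀ d → d < s → Σ ℕ λ v → X ⊢ diagonalTestP [ d ∷ n ∷ [] ]⇓ suc v
    below d d<s = n ∸ triangle (suc d) , ⇓-conv (+-∸-assoc 1 triangle≤n) (test d)
      where
        triangle≤n : triangle (suc d) ≤ n
        triangle≤n = ≤-trans (triangle-mono-≤ d<s) (≤-trans (m≤m+n (triangle s) b) (≤-reflexive (pair-unpair n)))

unpair₂P : PR 1
unpair₂P = c2 subP (prj zero) (c1 triangleP diagonalP)

unpair₂P-computes : Computes₁ unpair₂P unpair₂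
unpair₂P-computes n = ⇓-conv n∸triangle (ecomp (eprj ∷ ecomp (diagonalP-computes n ∷ []) (triangleP-computes _) ∷ []) (subP-computes _ _))
  where
    n∸triangle : n ∸ triangle (diagonal n) ≡ unpair₂ n
    n∸triangle = trans (cong (_∸ triangle (diagonal n)) (sym (pair-unpair n))) (m+n∸m≡n (triangle (diagonal n)) (unpair₂ n))

unpair₁P : PR 1
unpair₁P = c2 subP diagonalP unpair₂P

unpair₁P-computes : Computes₁ unpair₁P unpair₁
unpair₁P-computes n =
  ecomp (diagonalP-computes n ∷ unpair₂P-computes n ∷ []) (⇓-conv (m+n∸n≡m (unpair₁ n) (unpair₂ n)) (subP-computes _ _))

mod2P : PR 1
mod2P = prec zer (c1 isZeroP (prj (suc zero)))

mod2P-computes : Computes₁ mod2P (_% 2)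
mod2P-computes zero = eprec0 ezer
mod2P-computes (suc k) = ⇓-conv (sym ([1+n]%2≡isZero[n%2] k)) (eprecS (mod2P-computes k) (ecomp (eprj ∷ []) (isZeroP-computes _)))
  where
    [1+n]%2≡isZero[n%2] : ∀ n → suc n % 2 ≡ isZero (n % 2)
    [1+n]%2≡isZero[n%2] zero = refl
    [1+n]%2≡isZero[n%2] (suc zero) = refl
    [1+n]%2≡isZero[n%2] (suc (suc n)) = [1+n]%2≡isZero[n%2] n

halfP : PR 1
halfP = prec zer (c2 addP (prj (suc zero)) (c1 mod2P (prj zero)))

halfP-computes : Computes₁ halfP ⌊_/2⌋
halfP-computes zero = eprec0 ezer
halfP-computes (suc k) =
  ⇓-conv (sym (⌊1+n/2⌋≡⌊n/2⌋+n%2 k))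
    (eprecS (halfP-computes k) (ecomp (eprj ∷ ecomp (eprj ∷ []) (mod2P-computes k) ∷ []) (addP-computes _ _)))
  where
    ⌊1+n/2⌋≡⌊n/2⌋+n%2 : ∀ n → ⌊ suc n /2⌋ ≡ ⌊ n /2⌋ + n % 2
    ⌊1+n/2⌋≡⌊n/2⌋+n%2 zero = refl
    ⌊1+n/2⌋≡⌊n/2⌋+n%2 (suc zero) = refl
    ⌊1+n/2⌋≡⌊n/2⌋+n%2 (suc (suc n)) = cong suc (⌊1+n/2⌋≡⌊n/2⌋+n%2 n)

halvings : ℕ → ℕ → ℕ
halvings zero r = r
halvings (suc j) r = ⌊ halvings j r /2⌋

halvingsP : PR 2
halvingsP = prec (prj zero) (c1 halfP (prj (suc zero)))

halvingsP-computes : Computes₂ halvingsP halvings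
halvingsP-computes zero r = eprec0 eprj
halvingsP-computes (suc j) r = eprecS (halvingsP-computes j r) (ecomp (eprj ∷ []) (halfP-computes _))

bit≡halvings : ∀ j r → bit r j ≡ (halvings j r % 2 ≡ᵇ 1)
bit≡halvings zero r = refl
bit≡halvings (suc j) r = trans (bit≡halvings j ⌊ r /2⌋) (cong (λ x → x % 2 ≡ᵇ 1) (halvings-suc j r))
  where
    halvings-suc : ∀ j r → halvings j ⌊ r /2⌋ ≡ halvings (suc j) r
    halvings-suc zero r = refl
    halvings-suc (suc j) r = cong ⌊_/2⌋ (halvings-suc j r)

bitP : PR 2
bitP = c1 mod2P (c2 halvingsP (prj (suc zero)) (prj zero))

bitP-computes : Computes₂ bitP (λ r j → b2n (bit r j))
bitP-computes r j = ⇓-conv (sym (trans (cong b2n (bit≡halvings j r)) (b2n[n%2≡ᵇ1]≡n%2 (halvings j r))))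
  (c1-computes mod2P-computes (c2-computes halvingsP-computes (prj-computes (suc zero)) (prj-computes zero)) (r ∷ j ∷ []))
  where
    b2n[n%2≡ᵇ1]≡n%2 : ∀ n → b2n (n % 2 ≡ᵇ 1) ≡ n % 2
    b2n[n%2≡ᵇ1]≡n%2 zero = refl
    b2n[n%2≡ᵇ1]≡n%2 (suc zero) = refl
    b2n[n%2≡ᵇ1]≡n%2 (suc (suc n)) = b2n[n%2≡ᵇ1]≡n%2 n

popcountBelowP : PR 2
popcountBelowP = prec zer (c2 addP (prj (suc zero)) (c2 bitP (prj (suc (suc zero))) (prj zero)))

popcountBelowP-computes : Computes₂ popcountBelowP (λ N r → popcountBelow r N)
popcountBelowP-computes zero r = eprec0 ezer
popcountBelowP-computes (suc N) r =
  eprecS (popcountBelowP-computes N r) (ecomp (eprj ∷ ecomp (eprj ∷ eprj ∷ []) (bitP-computes _ _) ∷ []) (addP-computes _ _))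

evenCardP : PR 1
evenCardP = c1 isZeroP (c1 mod2P (c2 popcountBelowP (prj zero) (prj zero)))

evenCardP-computes : Computes₁ evenCardP (λ r → b2n (evenCard r))
evenCardP-computes r = ⇓-conv (cong (λ x → b2n (x % 2 ≡ᵇ 0)) (sym (sum-map-upTo (λ j → b2n (bit r j)) r)))
  (c1-computes isZeroP-computes (c1-computes mod2P-computes (c2-computes popcountBelowP-computes (prj-computes zero) (prj-computes zero))) (r ∷ []))

consP : ∀ {n} → PR n → PR n → PR n
consP b s = c2 addP b (c2 mulP (constP 2) s)

consP-computes : ∀ {n} {b s : PR n} (B : Vec ℕ n → Bool) {S} → Computes b (λ xs → b2n (B xs)) → Computes s S →
                 Computes (consP b s) (λ xs → B xs ∷₂ S xs)
consP-computes B db ds xs =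
  ecomp (db xs ∷ ecomp (constP-computes 2 xs ∷ ds xs ∷ []) (mulP-computes _ _) ∷ []) (addP-computes _ _)

notP : ∀ {n} → PR n → PR n
notP b = c2 subP (constP 1) b

notP-computes : ∀ {n} {b : PR n} (B : Vec ℕ n → Bool) → Computes b (λ xs → b2n (B xs)) → Computes (notP b) (λ xs → b2n (not (B xs)))
notP-computes B db xs = ⇓-conv (1∸b2n (B xs)) (ecomp (constP-computes 1 xs ∷ db xs ∷ []) (subP-computes _ _))
  where
    1∸b2n : ∀ b → 1 ∸ b2n b ≡ b2n (not b)
    1∸b2n false = refl
    1∸b2n true = refl

bit0P : PR 1
bit0P = c2 bitP (prj zero) (constP 0)

bit0 : Vec ℕ 1 → Bool
bit0 xs = bit (lookup xs zero) 0

bit0P-computes : Computes bit0P (λ xs → b2n (bit0 xs))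
bit0P-computes = c2-computes bitP-computes (prj-computes zero) (constP-computes 0)

toggleP : ℕ → PR 1
toggleP zero    = consP (notP bit0P) (c1 halfP (prj zero))
toggleP (suc k) = consP bit0P (c1 (toggleP k) (c1 halfP (prj zero)))

toggleP-computes : ∀ k → Computes₁ (toggleP k) (toggle k)
toggleP-computes zero r =
  consP-computes (λ xs → not (bit0 xs)) (notP-computes bit0 bit0P-computes)
    (c1-computes halfP-computes (prj-computes zero)) (r ∷ [])
toggleP-computes (suc k) r =
  consP-computes bit0 bit0P-computes
    (c1-computes (toggleP-computes k) (c1-computes halfP-computes (prj-computes zero))) (r ∷ [])

mutual
  dropOracle : ∀ {n} → PR n → PR n
  dropOracle zer = zer
  dropOracle sc = sc
  dropOracle (prj i) = prj i
  dropOracle orc = zer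
  dropOracle (comp f gs) = comp (dropOracle f) (dropOracle* gs)
  dropOracle (prec g h) = prec (dropOracle g) (dropOracle h)
  dropOracle (mu f) = mu (dropOracle f)

  dropOracle* : ∀ {n m} → Vec (PR n) m → Vec (PR n) m
  dropOracle* [] = []
  dropOracle* (g ∷ gs) = dropOracle g ∷ dropOracle* gs

mutual
  dropOracle-sound : ∀ {X n} {e : PR n} {xs y} → ∅ ⊢ e [ xs ]⇓ y → X ⊢ dropOracle e [ xs ]⇓ y
  dropOracle-sound ezer = ezer
  dropOracle-sound esc = esc
  dropOracle-sound eprj = eprj
  dropOracle-sound eorc = ezer
  dropOracle-sound (ecomp ds d) = ecomp (dropOracle*-sound ds) (dropOracle-sound d)
  dropOracle-sound (eprec0 d) = eprec0 (dropOracle-sound d)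
  dropOracle-sound (eprecS d d') = eprecS (dropOracle-sound d) (dropOracle-sound d')
  dropOracle-sound {X} (emu d below) = emu (dropOracle-sound d) (λ z lt → below-sound (below z lt))
    where
      below-sound : ∀ {n} {f : PR (suc n)} {xs z} → Σ ℕ (λ v → ∅ ⊢ f [ z ∷ xs ]⇓ suc v) → Σ ℕ (λ v → X ⊢ dropOracle f [ z ∷ xs ]⇓ suc v)
      below-sound (v , dd) = v , dropOracle-sound dd

  dropOracle*-sound : ∀ {X n m} {gs : Vec (PR n) m} {xs ys} → ∅ ⊢ gs [ xs ]⇓* ys → X ⊢ dropOracle* gs [ xs ]⇓* ys
  dropOracle*-sound [] = []
  dropOracle*-sound (d ∷ ds) = dropOracle-sound d ∷ dropOracle*-sound ds

guardP : PR 1 → PR 1 → PR 1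
guardP b P = comp (prec zer (comp P (prj (suc (suc zero)) ∷ []))) (b ∷ prj zero ∷ [])

guardP-0 : ∀ {X} {b P : PR 1} {x} → X ⊢ b [ x ∷ [] ]⇓ 0 → X ⊢ guardP b P [ x ∷ [] ]⇓ 0
guardP-0 db = ecomp (db ∷ eprj ∷ []) (eprec0 ezer)

guardP-1 : ∀ {X} {b P : PR 1} {x y} → X ⊢ b [ x ∷ [] ]⇓ 1 → X ⊢ P [ x ∷ [] ]⇓ y → X ⊢ guardP b P [ x ∷ [] ]⇓ y
guardP-1 db dp = ecomp (db ∷ eprj ∷ []) (eprecS (eprec0 ezer) (ecomp (eprj ∷ []) dp))

-- For injective g with X-computable values on the decidable set Dom S, g⁻¹ b is the least
-- a ∈ Dom S with g a ≡ b.
module SearchInverse (decideDomP : PR 2) (i : ℕ) (e : PR 1) where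
  domP : PR 2
  domP = comp decideDomP (constP i ∷ prj zero ∷ [])

  matchP : PR 4
  matchP = c1 isZeroP (c2 eqP (c1 e (prj (suc (suc zero)))) (prj (suc (suc (suc zero)))))

  testP : PR 2
  testP = comp (prec (constP 1) matchP) (domP ∷ prj zero ∷ prj (suc zero) ∷ [])

  invP : PR 1
  invP = mu testP

  module _ {X : Oracle} (S : Str) (g : ℕ → ℕ)
           (decideDomP-computes : ∀ a → X ⊢ decideDomP [ i ∷ a ∷ [] ]⇓ b2n (Dom S a))
           (e-computes : ∀ a → Dom S a ≡ true → X ⊢ e [ a ∷ [] ]⇓ g a)
           (g-injective : ∀ a a' → Dom S a ≡ true → Dom S a' ≡ true → g a ≡ g a' → a ≡ a') where

    testP-Dom : ∀ a b → Dom S a ≡ true → X ⊢ testP [ a ∷ b ∷ [] ]⇓ isZero (eqNat (g a) b)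
    testP-Dom a b d = ecomp (ecomp (constP-computes i _ ∷ eprj ∷ []) (⇓-conv (cong b2n d) (decideDomP-computes a)) ∷ eprj ∷ eprj ∷ [])
      (eprecS (eprec0 (constP-computes 1 _)) (ecomp (ecomp (ecomp (eprj ∷ []) (e-computes a d) ∷ eprj ∷ []) (eqP-computes _ _) ∷ []) (isZeroP-computes _)))

    testP-¬Dom : ∀ a b → Dom S a ≡ false → X ⊢ testP [ a ∷ b ∷ [] ]⇓ 1
    testP-¬Dom a b d = ecomp (ecomp (constP-computes i _ ∷ eprj ∷ []) (⇓-conv (cong b2n d) (decideDomP-computes a)) ∷ eprj ∷ eprj ∷ [])
      (eprec0 (constP-computes 1 _))

    invP-computes : ∀ b a → Dom S a ≡ true → g a ≡ b → X ⊢ invP [ b ∷ [] ]⇓ a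
    invP-computes b a da ga = emu (⇓-conv (cong (λ v → isZero (b2n v)) (trans (cong (_≡ᵇ b) ga) (≡ᵇ-refl b))) (testP-Dom a b da)) below
      where
        below : ∀ z → z < a → Σ ℕ λ v → X ⊢ testP [ z ∷ b ∷ [] ]⇓ suc v
        below z lt with Dom S z in dz
        ... | false = 0 , testP-¬Dom z b dz
        ... | true with g z ≡ᵇ b in ez
        ... | false = 0 , ⇓-conv (cong (λ v → isZero (b2n v)) ez) (testP-Dom z b dz)
        ... | true = ⊥-elim (<-irrefl (g-injective z a dz da (trans (≡ᵇ-true⇒≡ (g z) b ez) (sym ga))) lt)

-- Computing a relabelling: on the code of an element of the fibre over z, the fibre map is
-- selected by three flags computed from the code of z: apply g, apply g⁻¹, or keep the element.

module RelabelProgram (σCodeP useGP useGinvP keepP gP giP : PR 1) where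
  tagP restP pointP eltP : PR 1
  tagP = c1 unpair₁P (prj zero)
  restP = c1 unpair₂P (prj zero)
  pointP = c1 unpair₁P restP
  eltP = c1 unpair₂P restP

  -- selectP evaluates both of its branches, so on the code of a base point the fibre branch must
  -- halt too: there the flags are forced to 0, and neither g nor its inverse is called.
  flagP : PR 1 → PR 1
  flagP KP = c2 mulP (c2 eqP tagP (constP 1)) (c1 KP pointP)

  fibreMapP : PR 1
  fibreMapP = c2 addP (guardP (flagP useGP) (c1 gP eltP))
                      (c2 addP (guardP (flagP useGinvP) (c1 giP eltP)) (c2 mulP (c1 keepP pointP) eltP))

  relabelP : PR 1
  relabelP = selectP tagP (c2 pairP (constP 0) (c1 σCodeP restP))
                          (c2 pairP (constP 1) (c2 pairP (c1 σCodeP pointP) fibreMapP))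

  module Correctness {X : Oracle} (σCode useG useGinv keep : ℕ → ℕ)
     (σCodeP-computes : Computes₁ σCodeP σCode) (useGP-computes : Computes₁ useGP useG)
     (useGinvP-computes : Computes₁ useGinvP useGinv) (keepP-computes : Computes₁ keepP keep)
     (C C' : HElt → Str) (σfs : ℕ → ℕ) (σpt : ℕ → Bool → Bool) (h : HElt → ℕ → ℕ) where

    open Relabelling C C' σfs σpt h

    data FibreCase (z : HElt) (c : ℕ) : Set where
      viaG    : useG (encodeH z) ≡ 1 → useGinv (encodeH z) ≡ 0 → keep (encodeH z) ≡ 0 → X ⊢ gP [ c ∷ [] ]⇓ h z c → FibreCase z c
      viaGinv : useG (encodeH z) ≡ 0 → useGinv (encodeH z) ≡ 1 → keep (encodeH z) ≡ 0 → X ⊢ giP [ c ∷ [] ]⇓ h z c → FibreCase z c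
      viaId   : useG (encodeH z) ≡ 0 → useGinv (encodeH z) ≡ 0 → keep (encodeH z) ≡ 1 → h z c ≡ c → FibreCase z c

    tagP-⇓ : ∀ n → X ⊢ tagP [ n ∷ [] ]⇓ unpair₁ n
    tagP-⇓ n = c1-computes unpair₁P-computes (prj-computes zero) (n ∷ [])

    restP-⇓ : ∀ n → X ⊢ restP [ n ∷ [] ]⇓ unpair₂ n
    restP-⇓ n = c1-computes unpair₂P-computes (prj-computes zero) (n ∷ [])

    pointP-⇓ : ∀ n → X ⊢ pointP [ n ∷ [] ]⇓ unpair₁ (unpair₂ n)
    pointP-⇓ n = ecomp (restP-⇓ n ∷ []) (unpair₁P-computes _)

    eltP-⇓ : ∀ n → X ⊢ eltP [ n ∷ [] ]⇓ unpair₂ (unpair₂ n)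
    eltP-⇓ n = ecomp (restP-⇓ n ∷ []) (unpair₂P-computes _)

    flagP-⇓ : ∀ {KP K} → Computes₁ KP K → ∀ n → X ⊢ flagP KP [ n ∷ [] ]⇓ (eqNat (unpair₁ n) 1 * K (unpair₁ (unpair₂ n)))
    flagP-⇓ KP-computes n =
      ecomp (ecomp (tagP-⇓ n ∷ constP-computes 1 _ ∷ []) (eqP-computes _ _) ∷ ecomp (pointP-⇓ n ∷ []) (KP-computes _) ∷ []) (mulP-computes _ _)

    fibreMapP-⇓ : ∀ n {v₁ v₂} → X ⊢ guardP (flagP useGP) (c1 gP eltP) [ n ∷ [] ]⇓ v₁ →
                  X ⊢ guardP (flagP useGinvP) (c1 giP eltP) [ n ∷ [] ]⇓ v₂ →
                  X ⊢ fibreMapP [ n ∷ [] ]⇓ (v₁ + (v₂ + keep (unpair₁ (unpair₂ n)) * unpair₂ (unpair₂ n)))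
    fibreMapP-⇓ n d₁ d₂ =
      ecomp (d₁ ∷ ecomp (d₂ ∷ ecomp (ecomp (pointP-⇓ n ∷ []) (keepP-computes _) ∷ eltP-⇓ n ∷ []) (mulP-computes _ _) ∷ []) (addP-computes _ _) ∷ [])
        (addP-computes _ _)

    relabelP-⇓ : ∀ n {v} → X ⊢ fibreMapP [ n ∷ [] ]⇓ v →
                 X ⊢ relabelP [ n ∷ [] ]⇓ select (unpair₁ n) (pair 0 (σCode (unpair₂ n))) (pair 1 (pair (σCode (unpair₁ (unpair₂ n))) v))
    relabelP-⇓ n dv =
      selectP-⇓ (tagP-⇓ n)
        (ecomp (constP-computes 0 _ ∷ ecomp (restP-⇓ n ∷ []) (σCodeP-computes _) ∷ []) (pairP-computes _ _))
        (ecomp (constP-computes 1 _ ∷ ecomp (ecomp (pointP-⇓ n ∷ []) (σCodeP-computes _) ∷ dv ∷ []) (pairP-computes _ _) ∷ []) (pairP-computes _ _))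

    module FibreMapInC (z : HElt) (c : ℕ) where
      n : ℕ
      n = encodeC (inC z c)

      flag : ∀ {KP K} → Computes₁ KP K → X ⊢ flagP KP [ n ∷ [] ]⇓ K (encodeH z)
      flag {K = K} KP-computes = ⇓-conv flag≡ (flagP-⇓ KP-computes n)
        where
          flag≡ : eqNat (unpair₁ n) 1 * K (unpair₁ (unpair₂ n)) ≡ K (encodeH z)
          flag≡ rewrite unpair₁-encodeC-inC z c | unpair₁₂-encodeC-inC z c = +-identityʳ _

      apply : ∀ {P v} → X ⊢ P [ c ∷ [] ]⇓ v → X ⊢ c1 P eltP [ n ∷ [] ]⇓ v
      apply dP = ecomp (⇓-conv (unpair₂₂-encodeC-inC z c) (eltP-⇓ n) ∷ []) dP

      keepTerm : ∀ v₁ v₂ → v₁ + (v₂ + keep (unpair₁ (unpair₂ n)) * unpair₂ (unpair₂ n)) ≡ v₁ + (v₂ + keep (encodeH z) * c)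
      keepTerm v₁ v₂ rewrite unpair₁₂-encodeC-inC z c | unpair₂₂-encodeC-inC z c = refl

    fibreMapP-inC : ∀ z c → FibreCase z c → X ⊢ fibreMapP [ encodeC (inC z c) ∷ [] ]⇓ h z c
    fibreMapP-inC z c (viaG g₁ gi₀ k₀ dg) =
      ⇓-conv (trans (keepTerm (h z c) 0) (trans (cong (λ k → h z c + (0 + k * c)) k₀) (+-identityʳ _)))
        (fibreMapP-⇓ n (guardP-1 (⇓-conv g₁ (flag useGP-computes)) (apply dg)) (guardP-0 (⇓-conv gi₀ (flag useGinvP-computes))))
      where open FibreMapInC z c
    fibreMapP-inC z c (viaGinv g₀ gi₁ k₀ dgi) =
      ⇓-conv (trans (keepTerm 0 (h z c)) (trans (cong (λ k → h z c + k * c) k₀) (+-identityʳ _)))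
        (fibreMapP-⇓ n (guardP-0 (⇓-conv g₀ (flag useGP-computes))) (guardP-1 (⇓-conv gi₁ (flag useGinvP-computes)) (apply dgi)))
      where open FibreMapInC z c
    fibreMapP-inC z c (viaId g₀ gi₀ k₁ h≡id) =
      ⇓-conv (trans (keepTerm 0 0) (trans (cong (_* c) k₁) (trans (+-identityʳ c) (sym h≡id))))
        (fibreMapP-⇓ n (guardP-0 (⇓-conv g₀ (flag useGP-computes))) (guardP-0 (⇓-conv gi₀ (flag useGinvP-computes))))
      where open FibreMapInC z c

    module _ (σCode-encodeH : ∀ z → σCode (encodeH z) ≡ encodeH (σ z))
             (fibreCase : ∀ z c → Dom (C z) c ≡ true → FibreCase z c) where

      relabelP-base : ∀ z → X ⊢ relabelP [ encodeC (base z) ∷ [] ]⇓ encodeC (base (σ z))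
      relabelP-base z =
        ⇓-conv value (relabelP-⇓ n (fibreMapP-⇓ n (guardP-0 (⇓-conv (flag≡0 useG) (flagP-⇓ useGP-computes n)))
                                                   (guardP-0 (⇓-conv (flag≡0 useGinv) (flagP-⇓ useGinvP-computes n)))))
        where
          n : ℕ
          n = encodeC (base z)
          flag≡0 : ∀ K → eqNat (unpair₁ n) 1 * K (unpair₁ (unpair₂ n)) ≡ 0
          flag≡0 K rewrite unpair₁-encodeC-base z = refl
          value : select (unpair₁ n) (pair 0 (σCode (unpair₂ n))) _ ≡ encodeC (base (σ z))
          value rewrite unpair₁-encodeC-base z | unpair₂-encodeC-base z | σCode-encodeH z = refl

      relabelP-inC : ∀ z c → Dom (C z) c ≡ true → X ⊢ relabelP [ encodeC (inC z c) ∷ [] ]⇓ encodeC (inC (σ z) (h z c))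
      relabelP-inC z c dc = ⇓-conv value (relabelP-⇓ n (fibreMapP-inC z c (fibreCase z c dc)))
        where
          n : ℕ
          n = encodeC (inC z c)
          value : select (unpair₁ n) (pair 0 (σCode (unpair₂ n))) (pair 1 (pair (σCode (unpair₁ (unpair₂ n))) (h z c)))
                ≡ encodeC (inC (σ z) (h z c))
          value rewrite unpair₁-encodeC-inC z c | unpair₁₂-encodeC-inC z c | σCode-encodeH z = refl

      relabelP-computes : ∀ n → InDomC C n → X ⊢ relabelP [ n ∷ [] ]⇓ relabel n
      relabelP-computes n d with InDom-decode C n d
      ... | x , ex , dx =
        ⇓-conv (sym (relabel-decode n x ex))
          (subst (λ m → X ⊢ relabelP [ m ∷ [] ]⇓ encodeC (relabelElt x)) (decodeC-sound n x ex) (on-codes x dx))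
        where
          on-codes : ∀ x → DomDecoded C (just x) ≡ true → X ⊢ relabelP [ encodeC x ∷ [] ]⇓ encodeC (relabelElt x)
          on-codes (base z) _ = relabelP-base z
          on-codes (inC z c) dc = relabelP-inC z c dc

-- From an isomorphism Aᵢ ≅ Bᵢ to one of 𝓜 and 𝓝

id-isIso : ∀ S → IsIso S S (λ x → x)
id-isIso S = (λ a d → d) , (λ a a' _ _ e → e) , (λ b d → b , d , refl) , (λ k xs _ → cong (Rel S k) (sym (map-id xs)))

module InverseIso (S T : Str) (g : ℕ → ℕ) (iso : IsIso S T g) where
  gdom : ∀ a → InDom S a → InDom T (g a)
  gdom = iso-InDom {S} {T} iso
  ginj : ∀ a a' → InDom S a → InDom S a' → g a ≡ g a' → a ≡ a'
  ginj = iso-injective {S} {T} iso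
  gsurj : ∀ b → InDom T b → Σ ℕ λ a → InDom S a × g a ≡ b
  gsurj = iso-surjective {S} {T} iso
  grel : ∀ k xs → All (InDom S) xs → Rel S k xs ≡ Rel T k (map g xs)
  grel = iso-Rel {S} {T} iso

  ginvB : ∀ b (x : Bool) → Dom T b ≡ x → ℕ
  ginvB b true e = proj₁ (gsurj b e)
  ginvB b false e = 0

  ginv : ℕ → ℕ
  ginv b = ginvB b (Dom T b) refl

  ginv-spec : ∀ b → InDom T b → InDom S (ginv b) × g (ginv b) ≡ b
  ginv-spec b d = go (Dom T b) refl d
    where
      go : ∀ x (e : Dom T b ≡ x) → x ≡ true → InDom S (ginvB b x e) × g (ginvB b x e) ≡ b
      go true e _ = proj₂ (gsurj b e)
      go false e ()

  ginv-g : ∀ a → InDom S a → ginv (g a) ≡ a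
  ginv-g a d = ginj _ a (proj₁ (ginv-spec (g a) (gdom a d))) d (proj₂ (ginv-spec (g a) (gdom a d)))

  map-gg : ∀ xs → All (InDom T) xs → map g (map ginv xs) ≡ xs
  map-gg [] _ = refl
  map-gg (x ∷ xs) (d ∷ ds) = cong₂ _∷_ (proj₂ (ginv-spec x d)) (map-gg xs ds)

  all-ginv : ∀ xs → All (InDom T) xs → All (InDom S) (map ginv xs)
  all-ginv [] _ = []
  all-ginv (x ∷ xs) (d ∷ ds) = proj₁ (ginv-spec x d) ∷ all-ginv xs ds

  inverse-isIso : IsIso T S ginv
  inverse-isIso = (λ b d → proj₁ (ginv-spec b d)) ,
           (λ b b' d d' e → trans (sym (proj₂ (ginv-spec b d))) (trans (cong g e) (proj₂ (ginv-spec b' d')))) ,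
           (λ a d → g a , gdom a d , ginv-g a d) ,
           (λ k xs ds → sym (trans (grel k (map ginv xs) (all-ginv xs ds)) (cong (Rel T k) (map-gg xs ds))))

module ComputableInverse {T : Str} (A : ℕ → Str) (uA : UnifComputable A) (i : ℕ) {X : Oracle}
         (e : PR 1) (g : ℕ → ℕ) (e-computes : ∀ a → InDom (A i) a → X ⊢ e [ a ∷ [] ]⇓ g a)
         (isoG : IsIso (A i) T g) where
  open InverseIso (A i) T g isoG public

  ginvP : PR 1
  ginvP = SearchInverse.invP (dropOracle (proj₁ uA)) i e

  ginvP-computes : ∀ b → InDom T b → X ⊢ ginvP [ b ∷ [] ]⇓ ginv b
  ginvP-computes b d =
    SearchInverse.invP-computes (dropOracle (proj₁ uA)) i e (A i) g (λ a → dropOracle-sound (proj₁ (proj₂ (proj₂ uA)) i a))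
      e-computes ginj b (ginv b) (proj₁ (ginv-spec b d)) (proj₂ (ginv-spec b d))

encodeH-injective : ∀ z z' → encodeH z ≡ encodeH z' → z ≡ z'
encodeH-injective z z' e = just-injective (trans (sym (decodeH-encodeH z)) (trans (cong decodeH e) (decodeH-encodeH z')))

≢⇒≡ᵇ≡false : ∀ x y → (x ≡ y → ⊥) → (x ≡ᵇ y) ≡ false
≢⇒≡ᵇ≡false zero zero ne = ⊥-elim (ne refl)
≢⇒≡ᵇ≡false zero (suc y) ne = refl
≢⇒≡ᵇ≡false (suc x) zero ne = refl
≢⇒≡ᵇ≡false (suc x) (suc y) ne = ≢⇒≡ᵇ≡false x y (λ e → ne (cong suc e))

eqNat-refl : ∀ x → eqNat x x ≡ 1
eqNat-refl x = cong b2n (≡ᵇ-refl x)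

eqNat-encodeH-≢ : ∀ z z' → (z ≡ z' → ⊥) → eqNat (encodeH z) (encodeH z') ≡ 0
eqNat-encodeH-≢ z z' ne = cong b2n (≢⇒≡ᵇ≡false (encodeH z) (encodeH z') (λ e → ne (encodeH-injective z z' e)))

unpair₁P′ unpair₂P′ : PR 1
unpair₁P′ = c1 unpair₁P (prj zero)
unpair₂P′ = c1 unpair₂P (prj zero)

unpair₁P′-computes : Computes unpair₁P′ (λ v → unpair₁ (lookup v zero))
unpair₁P′-computes = c1-computes unpair₁P-computes (prj-computes zero)
unpair₂P′-computes : Computes unpair₂P′ (λ v → unpair₂ (lookup v zero))
unpair₂P′-computes = c1-computes unpair₂P-computes (prj-computes zero)

module FromZerothFactor (A B : ℕ → Str) (uA : UnifComputable A) (X : Oracle)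
         (e : PR 1) (g : ℕ → ℕ) (e-computes : ∀ a → InDom (A 0) a → X ⊢ e [ a ∷ [] ]⇓ g a)
         (isoG : IsIso (A 0) (B 0) g) where
  open ComputableInverse {B 0} A uA 0 e g e-computes isoG

  fibreMap : HElt → ℕ → ℕ
  fibreMap (fs r) with evenCard r
  ... | true = g
  ... | false = ginv
  fibreMap (pt _ _) = λ c → c

  open Relabelling (Mfam A B) (Nfam A B) (λ r → r) (λ _ a → a) fibreMap

  fibreIso : ∀ z → IsIso (Mfam A B z) (Nfam A B (σ z)) (fibreMap z)
  fibreIso (fs r) with evenCard r
  ... | true = isoG
  ... | false = inverse-isIso
  fibreIso (pt j false) = id-isIso (A (suc j))
  fibreIso (pt j true) = id-isIso (B (suc j))

  open Isomorphism (λ r → refl) (λ j a → refl) (λ r s i → refl) (λ r i j a → refl) fibreIso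

  useGP useGinvP keepP : PR 1
  useGP = c2 mulP (c1 isZeroP unpair₁P′) (c1 evenCardP unpair₂P′)
  useGinvP = c2 mulP (c1 isZeroP unpair₁P′) (notP (c1 evenCardP unpair₂P′))
  keepP = notP (c1 isZeroP unpair₁P′)

  useG useGinv keep : ℕ → ℕ
  useG w = isZero (unpair₁ w) * b2n (evenCard (unpair₂ w))
  useGinv w = isZero (unpair₁ w) * b2n (not (evenCard (unpair₂ w)))
  keep w = b2n (not (unpair₁ w ≡ᵇ 0))

  useGP-computes : Computes₁ useGP useG
  useGP-computes x =
    c2-computes mulP-computes (c1-computes isZeroP-computes unpair₁P′-computes) (c1-computes evenCardP-computes unpair₂P′-computes) (x ∷ [])

  useGinvP-computes : Computes₁ useGinvP useGinv
  useGinvP-computes x =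
    c2-computes mulP-computes (c1-computes isZeroP-computes unpair₁P′-computes)
      (notP-computes (λ xs → evenCard (unpair₂ (lookup xs zero))) (c1-computes evenCardP-computes unpair₂P′-computes)) (x ∷ [])

  keepP-computes : Computes₁ keepP keep
  keepP-computes x = notP-computes (λ xs → unpair₁ (lookup xs zero) ≡ᵇ 0) (c1-computes isZeroP-computes unpair₁P′-computes) (x ∷ [])

  open RelabelProgram (prj zero) useGP useGinvP keepP e ginvP
  open Correctness {X} (λ w → w) useG useGinv keep (λ x → eprj) useGP-computes useGinvP-computes keepP-computes
                   (Mfam A B) (Nfam A B) (λ r → r) (λ _ a → a) fibreMap

  fibreCase-fs : ∀ r c → Dom (Mfam A B (fs r)) c ≡ true → ∀ b → evenCard r ≡ b → FibreCase (fs r) c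
  fibreCase-fs r c dc true even = viaG useG≡1 useGinv≡0 keep≡0 (⇓-conv (sym map≡g) (e-computes c (trans (sym dom≡) dc)))
    where
      useG≡1 : useG (encodeH (fs r)) ≡ 1
      useG≡1 rewrite unpair₁-pair 0 r | unpair₂-pair 0 r | even = refl
      useGinv≡0 : useGinv (encodeH (fs r)) ≡ 0
      useGinv≡0 rewrite unpair₁-pair 0 r | unpair₂-pair 0 r | even = refl
      keep≡0 : keep (encodeH (fs r)) ≡ 0
      keep≡0 rewrite unpair₁-pair 0 r = refl
      map≡g : fibreMap (fs r) c ≡ g c
      map≡g rewrite even = refl
      dom≡ : Dom (Mfam A B (fs r)) c ≡ Dom (A 0) c
      dom≡ rewrite even = refl
  fibreCase-fs r c dc false odd = viaGinv useG≡0 useGinv≡1 keep≡0 (⇓-conv (sym map≡ginv) (ginvP-computes c (trans (sym dom≡) dc)))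
    where
      useG≡0 : useG (encodeH (fs r)) ≡ 0
      useG≡0 rewrite unpair₁-pair 0 r | unpair₂-pair 0 r | odd = refl
      useGinv≡1 : useGinv (encodeH (fs r)) ≡ 1
      useGinv≡1 rewrite unpair₁-pair 0 r | unpair₂-pair 0 r | odd = refl
      keep≡0 : keep (encodeH (fs r)) ≡ 0
      keep≡0 rewrite unpair₁-pair 0 r = refl
      map≡ginv : fibreMap (fs r) c ≡ ginv c
      map≡ginv rewrite odd = refl
      dom≡ : Dom (Mfam A B (fs r)) c ≡ Dom (B 0) c
      dom≡ rewrite odd = refl

  fibreCase : ∀ z c → Dom (Mfam A B z) c ≡ true → FibreCase z c
  fibreCase (fs r) c dc = fibreCase-fs r c dc (evenCard r) refl
  fibreCase (pt j a) c dc = viaId useG≡0 useGinv≡0 keep≡1 refl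
    where
      tag : unpair₁ (encodeH (pt j a)) ≡ 1
      tag = unpair₁-pair 1 (pair j (b2n a))
      useG≡0 : useG (encodeH (pt j a)) ≡ 0
      useG≡0 rewrite tag = refl
      useGinv≡0 : useGinv (encodeH (pt j a)) ≡ 0
      useGinv≡0 rewrite tag = refl
      keep≡1 : keep (encodeH (pt j a)) ≡ 1
      keep≡1 rewrite tag = refl

  isoSpec : IsoSpec (𝓜 A B) (𝓝 A B) X
  isoSpec = relabelP , relabel , relabelP-computes σ-id fibreCase , relabel-isIso
    where
      σ-id : ∀ z → encodeH z ≡ encodeH (σ z)
      σ-id (fs r) = refl
      σ-id (pt j a) = refl

b2n-xor : ∀ a q → b2n (a xor q) ≡ (b2n a + b2n q) % 2
b2n-xor false false = refl
b2n-xor false true = refl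
b2n-xor true false = refl
b2n-xor true true = refl

eqB-xor : ∀ x a q → eqB (x xor q) (a xor q) ≡ eqB x a
eqB-xor false false false = refl
eqB-xor false false true = refl
eqB-xor false true false = refl
eqB-xor false true true = refl
eqB-xor true false false = refl
eqB-xor true false true = refl
eqB-xor true true false = refl
eqB-xor true true true = refl

module FromSuccFactor (A B : ℕ → Str) (uA : UnifComputable A) (X : Oracle) (j : ℕ)
         (e : PR 1) (g : ℕ → ℕ) (e-computes : ∀ a → InDom (A (suc j)) a → X ⊢ e [ a ∷ [] ]⇓ g a)
         (isoG : IsIso (A (suc j)) (B (suc j)) g) where
  open ComputableInverse {B (suc j)} A uA (suc j) e g e-computes isoG

  σfs : ℕ → ℕ
  σfs = toggle j
  σpt : ℕ → Bool → Bool
  σpt i a = a xor (i ≡ᵇ j)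

  fibreMap-pt : Bool → Bool → ℕ → ℕ
  fibreMap-pt false _ c = c
  fibreMap-pt true false = g
  fibreMap-pt true true = ginv

  fibreMap : HElt → ℕ → ℕ
  fibreMap (fs r) c = c
  fibreMap (pt i a) = fibreMap-pt (i ≡ᵇ j) a

  open Relabelling (Mfam A B) (Nfam A B) σfs σpt fibreMap

  fibreIso-fs : ∀ x y → evenCard y ≡ not (evenCard x) → IsIso (Mfam A B (fs x)) (Nfam A B (fs y)) (λ c → c)
  fibreIso-fs x y parity with evenCard x | evenCard y
  ... | true | false = id-isIso (A 0)
  ... | false | true = id-isIso (B 0)
  fibreIso-fs x y () | true | true
  fibreIso-fs x y () | false | false

  fibreIso-pt : ∀ i a q → (i ≡ᵇ j) ≡ q → IsIso (Mfam A B (pt i a)) (Nfam A B (pt i (a xor q))) (fibreMap-pt q a)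
  fibreIso-pt i false false _ = id-isIso (A (suc i))
  fibreIso-pt i true false _ = id-isIso (B (suc i))
  fibreIso-pt i a true eq with ≡ᵇ-true⇒≡ i j eq
  fibreIso-pt i false true eq | refl = isoG
  fibreIso-pt i true true eq | refl = inverse-isIso

  fibreIso : ∀ z → IsIso (Mfam A B z) (Nfam A B (σ z)) (fibreMap z)
  fibreIso (fs r) = fibreIso-fs r (toggle j r) (evenCard-toggle j r)
  fibreIso (pt i a) = fibreIso-pt i a (i ≡ᵇ j) refl

  σ-DRel : ∀ r k i a → ((i ≡ᵇ k) ∧ eqB (bit (σfs r) k) (σpt i a)) ≡ ((i ≡ᵇ k) ∧ eqB (bit r k) a)
  σ-DRel r k i a with i ≡ᵇ k in eq
  ... | false = refl
  ... | true with ≡ᵇ-true⇒≡ i k eq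
  ... | refl rewrite bit-toggle j r i = eqB-xor (bit r i) a (i ≡ᵇ j)

  open Isomorphism (toggle-involutive j) (λ i a → xor-cancelʳ a (i ≡ᵇ j)) (symDiffIs-toggle j) σ-DRel fibreIso

  σCodeP : PR 1
  σCodeP = selectP unpair₁P′ (c2 pairP (constP 0) (c1 (toggleP j) unpair₂P′))
                  (c2 pairP (constP 1) (c2 pairP (c1 unpair₁P unpair₂P′) (c1 mod2P (c2 addP (c1 unpair₂P unpair₂P′) (c2 eqP (c1 unpair₁P unpair₂P′) (constP j))))))
  σCode : ℕ → ℕ
  σCode w = select (unpair₁ w) (pair 0 (toggle j (unpair₂ w)))
                (pair 1 (pair (unpair₁ (unpair₂ w)) ((unpair₂ (unpair₂ w) + eqNat (unpair₁ (unpair₂ w)) j) % 2)))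
  σCodeP-computes : Computes₁ σCodeP σCode
  σCodeP-computes x = selectP-⇓ (unpair₁P′-computes xs)
    (c2-computes pairP-computes (constP-computes 0) (c1-computes (toggleP-computes j) unpair₂P′-computes) xs)
    (c2-computes pairP-computes (constP-computes 1)
      (c2-computes pairP-computes (c1-computes unpair₁P-computes unpair₂P′-computes)
        (c1-computes mod2P-computes
          (c2-computes addP-computes (c1-computes unpair₂P-computes unpair₂P′-computes)
            (c2-computes eqP-computes (c1-computes unpair₁P-computes unpair₂P′-computes) (constP-computes j))))) xs)
    where xs = x ∷ []

  σCode-encodeH : ∀ z → σCode (encodeH z) ≡ encodeH (σ z)
  σCode-encodeH (fs r) rewrite unpair₁-pair 0 r | unpair₂-pair 0 r = refl
  σCode-encodeH (pt i a) rewrite unpair₁-pair 1 (pair i (b2n a)) | unpair₂-pair 1 (pair i (b2n a)) | unpair₁-pair i (b2n a) | unpair₂-pair i (b2n a)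
    = cong (λ v → pair 1 (pair i v)) (sym (b2n-xor a (i ≡ᵇ j)))

  z₀ z₁ : HElt
  z₀ = pt j false
  z₁ = pt j true
  useGP useGinvP keepP : PR 1
  useGP = c2 eqP (prj zero) (constP (encodeH z₀))
  useGinvP = c2 eqP (prj zero) (constP (encodeH z₁))
  keepP = c2 subP (constP 1) (c2 addP useGP useGinvP)
  useG useGinv keep : ℕ → ℕ
  useG w = eqNat w (encodeH z₀)
  useGinv w = eqNat w (encodeH z₁)
  keep w = 1 ∸ (useG w + useGinv w)
  useGP-computes : Computes₁ useGP useG
  useGP-computes x = c2-computes eqP-computes (prj-computes zero) (constP-computes (encodeH z₀)) (x ∷ [])
  useGinvP-computes : Computes₁ useGinvP useGinv
  useGinvP-computes x = c2-computes eqP-computes (prj-computes zero) (constP-computes (encodeH z₁)) (x ∷ [])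
  keepP-computes : Computes₁ keepP keep
  keepP-computes x = ecomp (constP-computes 1 _ ∷ ecomp (useGP-computes x ∷ useGinvP-computes x ∷ []) (addP-computes _ _) ∷ []) (subP-computes _ _)

  open RelabelProgram σCodeP useGP useGinvP keepP e ginvP
  open Correctness {X} σCode useG useGinv keep σCodeP-computes useGP-computes useGinvP-computes keepP-computes (Mfam A B) (Nfam A B) σfs σpt fibreMap

  fs≢pt : ∀ r a → fs r ≡ pt j a → ⊥
  fs≢pt r a ()

  z₀≢z₁ : z₀ ≡ z₁ → ⊥
  z₀≢z₁ ()

  fibreCase-off : ∀ z c → (z ≡ z₀ → ⊥) → (z ≡ z₁ → ⊥) → fibreMap z c ≡ c → FibreCase z c
  fibreCase-off z c z≢z₀ z≢z₁ map≡id = viaId (eqNat-encodeH-≢ z z₀ z≢z₀) (eqNat-encodeH-≢ z z₁ z≢z₁) keep≡1 map≡id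
    where
      keep≡1 : keep (encodeH z) ≡ 1
      keep≡1 rewrite eqNat-encodeH-≢ z z₀ z≢z₀ | eqNat-encodeH-≢ z z₁ z≢z₁ = refl

  fibreMap-pt-≡ : ∀ i a c q → (i ≡ᵇ j) ≡ q → fibreMap (pt i a) c ≡ fibreMap-pt q a c
  fibreMap-pt-≡ i a c q eq rewrite eq = refl

  fibreCase-pt : ∀ i a c → Dom (Mfam A B (pt i a)) c ≡ true → ∀ q → (i ≡ᵇ j) ≡ q → FibreCase (pt i a) c
  fibreCase-pt i a c dc false eq = fibreCase-off (pt i a) c (ne eq) (ne eq) (fibreMap-pt-≡ i a c false eq)
    where
      ne : ∀ {b} → (i ≡ᵇ j) ≡ false → pt i a ≡ pt j b → ⊥
      ne eq' refl with trans (sym eq') (≡ᵇ-refl j)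
      ... | ()
  fibreCase-pt i a c dc true eq with ≡ᵇ-true⇒≡ i j eq
  fibreCase-pt i false c dc true eq | refl =
    viaG (eqNat-refl (encodeH z₀)) (eqNat-encodeH-≢ z₀ z₁ z₀≢z₁) keep≡0 (⇓-conv (sym (fibreMap-pt-≡ j false c true eq)) (e-computes c dc))
    where
      keep≡0 : keep (encodeH z₀) ≡ 0
      keep≡0 rewrite eqNat-refl (encodeH z₀) | eqNat-encodeH-≢ z₀ z₁ z₀≢z₁ = refl
  fibreCase-pt i true c dc true eq | refl =
    viaGinv (eqNat-encodeH-≢ z₁ z₀ (z₀≢z₁ ∘ sym)) (eqNat-refl (encodeH z₁)) keep≡0 (⇓-conv (sym (fibreMap-pt-≡ j true c true eq)) (ginvP-computes c dc))
    where
      keep≡0 : keep (encodeH z₁) ≡ 0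
      keep≡0 rewrite eqNat-refl (encodeH z₁) | eqNat-encodeH-≢ z₁ z₀ (z₀≢z₁ ∘ sym) = refl

  fibreCase : ∀ z c → Dom (Mfam A B z) c ≡ true → FibreCase z c
  fibreCase (fs r) c dc = fibreCase-off (fs r) c (fs≢pt r false) (fs≢pt r true) refl
  fibreCase (pt i a) c dc = fibreCase-pt i a c dc (i ≡ᵇ j) refl

  isoSpec : IsoSpec (𝓜 A B) (𝓝 A B) X
  isoSpec = relabelP , relabel , relabelP-computes σCode-encodeH fibreCase , relabel-isIso

-- From an isomorphism of 𝓜 and 𝓝 to one of some Aᵢ ≅ Bᵢ

someBit : ∀ fuel t → t ≤ fuel → (t ≡ 0 → ⊥) → Σ ℕ λ j → bit t j ≡ true
someBit fuel zero _ ne = ⊥-elim (ne refl)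
someBit (suc fuel) (suc zero) _ _ = 0 , refl
someBit (suc fuel) (suc (suc t')) (s≤s le) _ with t' % 2 ≡ᵇ 1 in e
... | true = 0 , e
... | false with someBit fuel (suc ⌊ t' /2⌋) (≤-trans (s≤s (⌊n/2⌋≤n t')) le) (λ ())
... | j , bj = suc j , bj

DRelDecoded-true : ∀ i y y' → DRelDecoded i (just y) (just y') ≡ true →
        Σ ℕ λ t → Σ Bool λ a → (y ≡ base (fs t)) × (y' ≡ base (pt i a)) × (bit t i ≡ a)
DRelDecoded-true i (base (fs t)) (base (pt j a)) e with ∧-true⇒ (j ≡ᵇ i) (eqB (bit t i) a) e
... | e1 , e2 with ≡ᵇ-true⇒≡ j i e1
... | refl = t , a , refl , refl , eqB-true⇒≡ (bit t i) a e2
DRelDecoded-true i (base (fs t)) (base (fs _)) ()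
DRelDecoded-true i (base (fs t)) (inC _ _) ()
DRelDecoded-true i (base (pt _ _)) _ ()
DRelDecoded-true i (inC _ _) _ ()

DRel-∅-pt0 : ∀ j → DRelDecoded j (just (base (fs 0))) (just (base (pt j false))) ≡ true
DRel-∅-pt0 j rewrite ≡ᵇ-refl j | bit-beyond 0 j z≤n = refl

module FactorFromIso (C C' : HElt → Str) (X : Oracle) (e : PR 1) (f : ℕ → ℕ)
   (e-computes : ∀ a → InDomC C a → X ⊢ e [ a ∷ [] ]⇓ f a)
   (iso : IsIso (composite C) (composite C') f) where

  fdom : ∀ a → InDomC C a → InDomC C' (f a)
  fdom = iso-InDom {composite C} {composite C'} iso
  finj : ∀ a a' → InDomC C a → InDomC C a' → f a ≡ f a' → a ≡ a'
  finj = iso-injective {composite C} {composite C'} iso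
  fsurj : ∀ b → InDomC C' b → Σ ℕ λ a → InDomC C a × f a ≡ b
  fsurj = iso-surjective {composite C} {composite C'} iso
  frel : ∀ k xs → All (InDomC C) xs → Rel (composite C) k xs ≡ Rel (composite C') k (map f xs)
  frel = iso-Rel {composite C} {composite C'} iso

  CompRel-preserved : ∀ p xs → All (InDomC C) xs → CompRel' C p xs ≡ CompRel' C' p (map f xs)
  CompRel-preserved p xs ds = subst (λ q → CompRel' C q xs ≡ CompRel' C' q (map f xs)) (unpair-pair (proj₁ p) (proj₂ p)) (frel (uncurry pair p) xs ds)

  InDomC-encodeC : ∀ x → DomDecoded C (just x) ≡ true → InDomC C (encodeC x)
  InDomC-encodeC x d = trans (CompDom-decoded C (encodeC x)) (trans (cong (DomDecoded C) (decodeC-encodeC x)) d)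

  decode-image : ∀ x → DomDecoded C (just x) ≡ true → Σ CElt λ y → (decodeC (f (encodeC x)) ≡ just y) × (DomDecoded C' (just y) ≡ true)
  decode-image x d = InDom-decode C' (f (encodeC x)) (fdom (encodeC x) (InDomC-encodeC x d))

  decodeC-same⇒≡ : ∀ n m y → decodeC n ≡ just y → decodeC m ≡ just y → n ≡ m
  decodeC-same⇒≡ n m y e1 e2 = trans (sym (decodeC-sound n y e1)) (decodeC-sound m y e2)

  MuDecoded-preserved : ∀ x x' → DomDecoded C (just x) ≡ true → DomDecoded C (just x') ≡ true →
           MuDecoded (just x) (just x') ≡ MuDecoded (decodeC (f (encodeC x))) (decodeC (f (encodeC x')))
  MuDecoded-preserved x x' d d' =
    trans (sym (cong₂ MuDecoded (decodeC-encodeC x) (decodeC-encodeC x')))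
      (trans (sym (MuRel-decoded (encodeC x) (encodeC x')))
        (trans (CompRel-preserved (1 , 0) (encodeC x ∷ encodeC x' ∷ []) (InDomC-encodeC x d ∷ InDomC-encodeC x' d' ∷ []))
          (MuRel-decoded (f (encodeC x)) (f (encodeC x')))))

  DRelDecoded-preserved : ∀ i x x' → DomDecoded C (just x) ≡ true → DomDecoded C (just x') ≡ true →
           DRelDecoded i (just x) (just x') ≡ DRelDecoded i (decodeC (f (encodeC x))) (decodeC (f (encodeC x')))
  DRelDecoded-preserved i x x' d d' =
    trans (sym (cong₂ (DRelDecoded i) (decodeC-encodeC x) (decodeC-encodeC x')))
      (trans (sym (DRel-decoded i (encodeC x) (encodeC x')))
        (trans (sym (HSym-DRel (encodeC x ∷ encodeC x' ∷ [])))
          (trans (CompRel-preserved (0 , pair 1 i) (encodeC x ∷ encodeC x' ∷ []) (InDomC-encodeC x d ∷ InDomC-encodeC x' d' ∷ []))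
            (trans (HSym-DRel (map f (encodeC x ∷ encodeC x' ∷ []))) (DRel-decoded i (f (encodeC x)) (f (encodeC x')))))))
    where
      HSym-DRel : ∀ xs → HSym (unpair (pair 1 i)) xs ≡ DRel i xs
      HSym-DRel xs = cong (λ q → HSym q xs) (unpair-pair 1 i)

  image-∅ : Σ ℕ λ t → decodeC (f (encodeC (base (fs 0)))) ≡ just (base (fs t))
  image-∅ with decode-image (base (fs 0)) refl | decode-image (base (pt 0 false)) refl
  ... | y , fy , _ | y' , fy' , _
      with DRelDecoded-true 0 y y' (trans (sym (cong₂ (DRelDecoded 0) fy fy')) (sym (DRelDecoded-preserved 0 (base (fs 0)) (base (pt 0 false)) refl refl)))
  ...   | t , _ , refl , _ , _ = t , fy

  image-pt : ∀ t j → decodeC (f (encodeC (base (fs 0)))) ≡ just (base (fs t)) → bit t j ≡ true →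
             decodeC (f (encodeC (base (pt j false)))) ≡ just (base (pt j true))
  image-pt t j f∅≡t bit-j with decode-image (base (pt j false)) refl
  ... | y , fy , _
      with DRelDecoded-true j (base (fs t)) y
             (trans (sym (cong₂ (DRelDecoded j) f∅≡t fy)) (trans (sym (DRelDecoded-preserved j (base (fs 0)) (base (pt j false)) refl refl)) (DRel-∅-pt0 j)))
  ...   | _ , a , refl , refl , bit≡a = trans fy (cong (λ v → just (base (pt j v))) (trans (sym bit≡a) bit-j))

  -- A composite structure does not see the 0-ary relations of its fibres, so for those the
  -- fibre isomorphism needs the extra hypothesis nullary.
  module Fibre (z z' : HElt) (f-base : decodeC (f (encodeC (base z))) ≡ just (base z'))
                 (nullary : ∀ k → Rel (C z) k [] ≡ Rel (C' z') k []) where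
    S : Str
    S = C z
    T : Str
    T = C' z'

    g : ℕ → ℕ
    g a = unpair₂ (unpair₂ (f (encodeC (inC z a))))

    gP : PR 1
    gP = c1 unpair₂P (c1 unpair₂P (c1 e (c2 pairP (constP 1) (c2 pairP (constP (encodeH z)) (prj zero)))))

    image-inC : ∀ a → Dom S a ≡ true → (decodeC (f (encodeC (inC z a))) ≡ just (inC z' (g a))) × (Dom T (g a) ≡ true)
    image-inC a da with decode-image (inC z a) da
    ... | y , ey , dy = go y ey dy (trans (sym (trans (MuDecoded-preserved (inC z a) (base z) da refl) (cong₂ MuDecoded ey f-base))) (eqH-refl z))
      where
        go : ∀ y → decodeC (f (encodeC (inC z a))) ≡ just y → DomDecoded C' (just y) ≡ true → MuDecoded (just y) (just (base z')) ≡ true →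
             (decodeC (f (encodeC (inC z a))) ≡ just (inC z' (g a))) × (Dom T (g a) ≡ true)
        go (base w) ey dy m with eqH-true⇒≡ w z' m
        ... | refl = ⊥-elim (ne (encodeC-injective _ _ (finj _ _ (InDomC-encodeC (inC z a) da) (InDomC-encodeC (base z) refl) (decodeC-same⇒≡ _ _ (base z') ey f-base))))
          where
            ne : inC z a ≡ base z → ⊥
            ne ()
        go (inC w c) ey dy m with eqH-true⇒≡ w z' m
        ... | refl = trans ey (cong (λ v → just (inC z' v)) (sym gc)) , subst (λ v → Dom T v ≡ true) (sym gc) dy
          where
            gc : g a ≡ c
            gc = trans (cong (λ n → unpair₂ (unpair₂ n)) (sym (decodeC-sound (f (encodeC (inC z a))) (inC z' c) ey)))
                   (trans (cong unpair₂ (unpair₂-pair 1 (pair (encodeH z') c))) (unpair₂-pair (encodeH z') c))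

    gP-computes : ∀ a → Dom S a ≡ true → X ⊢ gP [ a ∷ [] ]⇓ g a
    gP-computes a da = ecomp (ecomp (ecomp (ecomp (constP-computes 1 _ ∷ ecomp (constP-computes (encodeH z) _ ∷ eprj ∷ []) (pairP-computes _ _) ∷ []) (pairP-computes _ _) ∷ []) (e-computes _ (InDomC-encodeC (inC z a) da)) ∷ []) (unpair₂P-computes _) ∷ []) (unpair₂P-computes _)

    f-encodeC-inC : ∀ a → Dom S a ≡ true → f (encodeC (inC z a)) ≡ encodeC (inC z' (g a))
    f-encodeC-inC a da = sym (decodeC-sound _ _ (proj₁ (image-inC a da)))

    g-injective : ∀ a a' → Dom S a ≡ true → Dom S a' ≡ true → g a ≡ g a' → a ≡ a'
    g-injective a a' da da' eq = cong eltOf (encodeC-injective (inC z a) (inC z a') (finj (encodeC (inC z a)) (encodeC (inC z a')) (InDomC-encodeC (inC z a) da) (InDomC-encodeC (inC z a') da')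
                            (trans (f-encodeC-inC a da) (trans (cong (λ v → encodeC (inC z' v)) eq) (sym (f-encodeC-inC a' da'))))))

    g-surjective : ∀ b → Dom T b ≡ true → Σ ℕ λ a → (Dom S a ≡ true) × g a ≡ b
    g-surjective b db with fsurj (encodeC (inC z' b)) (trans (CompDom-decoded C' (encodeC (inC z' b))) (trans (cong (DomDecoded C') (decodeC-encodeC (inC z' b))) db))
    ... | a0 , da0 , fa0 with InDom-decode C a0 da0
    ... | x0 , ex0 , dx0 = go x0 ex0 dx0 muT
      where
        a0x : a0 ≡ encodeC x0
        a0x = sym (decodeC-sound a0 x0 ex0)
        fx0 : decodeC (f (encodeC x0)) ≡ just (inC z' b)
        fx0 = trans (cong (λ n → decodeC (f n)) (sym a0x)) (trans (cong decodeC fa0) (decodeC-encodeC (inC z' b)))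
        muT : MuDecoded (just x0) (just (base z)) ≡ true
        muT = trans (MuDecoded-preserved x0 (base z) dx0 refl) (trans (cong₂ MuDecoded fx0 f-base) (eqH-refl z'))
        go : ∀ x → decodeC a0 ≡ just x → DomDecoded C (just x) ≡ true → MuDecoded (just x) (just (base z)) ≡ true → Σ ℕ λ a → (Dom S a ≡ true) × g a ≡ b
        go (base w) ex dx m with eqH-true⇒≡ w z m
        ... | refl with trans (cong (λ n → decodeC (f n)) (decodeC-sound a0 (base z) ex)) (trans (cong decodeC fa0) (decodeC-encodeC (inC z' b)))
        ... | q with trans (sym f-base) q
        ... | ()
        go (inC w c) ex dx m with eqH-true⇒≡ w z m
        ... | refl = c , dx , cong eltOf (just-injective (trans (sym (proj₁ (image-inC c dx)))
                        (trans (cong (λ n → decodeC (f n)) (decodeC-sound a0 (inC z c) ex)) (trans (cong decodeC fa0) (decodeC-encodeC (inC z' b))))))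

    inCCodes : HElt → List ℕ → List ℕ
    inCCodes w = map (λ c → encodeC (inC w c))

    collect-inCCodes : ∀ w cs → collect w (inCCodes w cs) ≡ just cs
    collect-inCCodes w [] = refl
    collect-inCCodes w (c ∷ cs) rewrite collect-∷ w (encodeC (inC w c)) (inCCodes w cs) | decodeC-encodeC (inC w c) | collect-inCCodes w cs | eqH-refl w = refl

    All-InDomC-inCCodes : ∀ cs → All (λ c → Dom S c ≡ true) cs → All (InDomC C) (inCCodes z cs)
    All-InDomC-inCCodes [] _ = []
    All-InDomC-inCCodes (c ∷ cs) (d ∷ ds) = InDomC-encodeC (inC z c) d ∷ All-InDomC-inCCodes cs ds

    map-f-inCCodes : ∀ cs → All (λ c → Dom S c ≡ true) cs → map f (inCCodes z cs) ≡ inCCodes z' (map g cs)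
    map-f-inCCodes [] _ = refl
    map-f-inCCodes (c ∷ cs) (d ∷ ds) = cong₂ _∷_ (f-encodeC-inC c d) (map-f-inCCodes cs ds)

    CRel-inCCodes : ∀ (D : HElt → Str) k w c cs → CRel D k (inCCodes w (c ∷ cs)) ≡ Rel (D w) k (c ∷ cs)
    CRel-inCCodes D k w c cs = trans (CRel-decoded D k (encodeC (inC w c)) (inCCodes w cs))
      (trans (cong (λ m → CRelDecoded D k m (inCCodes w (c ∷ cs))) (decodeC-encodeC (inC w c)))
        (cong (RelOfCollected D k w) (collect-inCCodes w (c ∷ cs))))

    g-Rel : ∀ k cs → All (λ c → Dom S c ≡ true) cs → Rel S k cs ≡ Rel T k (map g cs)
    g-Rel k [] _ = nullary k
    g-Rel k (c ∷ cs) ds = begin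
        Rel S k (c ∷ cs) ≡⟨ sym (CRel-inCCodes C k z c cs) ⟩
        CRel C k (inCCodes z (c ∷ cs)) ≡⟨ CompRel-preserved (2 , k) (inCCodes z (c ∷ cs)) (All-InDomC-inCCodes (c ∷ cs) ds) ⟩
        CRel C' k (map f (inCCodes z (c ∷ cs))) ≡⟨ cong (CRel C' k) (map-f-inCCodes (c ∷ cs) ds) ⟩
        CRel C' k (inCCodes z' (g c ∷ map g cs)) ≡⟨ CRel-inCCodes C' k z' (g c) (map g cs) ⟩
        Rel T k (map g (c ∷ cs)) ∎
      where open ≡-Reasoning

    isoSpec : IsoSpec S T X
    isoSpec = gP , g , gP-computes , ((λ a d → proj₂ (image-inC a d)) , g-injective , g-surjective , g-Rel)

isoSpec-composite⇒factor : (A B : ℕ → Str) → (∀ i → Isomorphic (A i) (B i)) → ∀ X →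
                           IsoSpec (𝓜 A B) (𝓝 A B) X → ∃ λ i → IsoSpec (A i) (B i) X
isoSpec-composite⇒factor A B isoAB X (e , f , e-computes , iso) = factor image-∅
  where
    open FactorFromIso (Mfam A B) (Nfam A B) X e f e-computes iso

    nullary : ∀ i k → Rel (A i) k [] ≡ Rel (B i) k []
    nullary i k = iso-Rel {A i} {B i} (proj₂ (isoAB i)) k [] []

    factor : Σ ℕ (λ t → decodeC (f (encodeC (base (fs 0)))) ≡ just (base (fs t))) → ∃ λ i → IsoSpec (A i) (B i) X
    factor (t , f∅≡t) with t ≟ 0
    ... | yes refl = 0 , Fibre.isoSpec (fs 0) (fs 0) f∅≡t (nullary 0)
    ... | no t≢0 with someBit t t ≤-refl t≢0
    ...   | j , bit-j = suc j , Fibre.isoSpec (pt j false) (pt j true) (image-pt t j f∅≡t bit-j) (nullary (suc j))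

isoSpec-factor⇒composite : (A B : ℕ → Str) → UnifComputable A → ∀ X →
                           ∃ (λ i → IsoSpec (A i) (B i) X) → IsoSpec (𝓜 A B) (𝓝 A B) X
isoSpec-factor⇒composite A B uA X (zero , e , g , e-computes , isoG) = FromZerothFactor.isoSpec A B uA X e g e-computes isoG
isoSpec-factor⇒composite A B uA X (suc j , e , g , e-computes , isoG) = FromSuccFactor.isoSpec A B uA X j e g e-computes isoG

proposition3p17 : (A B : ℕ → Str) → UnifComputable A → UnifComputable B →
                  (∀ i → Isomorphic (A i) (B i)) →
                  ∀ (X : Oracle) → IsoSpec (𝓜 A B) (𝓝 A B) X ⇔ ∃ (λ i → IsoSpec (A i) (B i) X)
proposition3p17 A B uA _ isoAB X = mk⇔ (isoSpec-composite⇒factor A B isoAB X) (isoSpec-factor⇒composite A B uA X)
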